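{- Let $H$ be a graph, let $p,q\ge3$, and let $\mathcal{X}=\{(p,q),(q,p)\}$. (i) If $H$ is an induced subgraph of $D^p_k+D^q_k$ for some $k\ge0$, then $H$ covers every pair in $\mathcal{X}$. (ii) If $D^p_k+D^q_k$ is an induced subgraph of $H$ for some $k\ge0$, then $H$ covers no pair $(i,j)$ (with $i,j\ge3$) outside $\mathcal{X}$.
   Context: Graphs are finite and simple. $P_k$: path on $k$ vertices; $C_r$: cycle on $r$ vertices; $+$: disjoint union. For $k\ge0$, $r\ge3$, $D^r_k$ is obtained from $P_k+C_r$ by adding an edge between a vertex of the cycle and an end-vertex of the path ($D^r_0=C_r$). For $i,j\ge3$, $k\ge1$, the butterfly $B_{i,j,k}$ is obtained from $C_i+C_j$ by choosing a vertex $x$ of $C_i$ and $y$ of $C_j$ and adding a path with $k$ edges between $x$ and $y$. A graph $H$ covers the pair $(i,j)$ ($i,j\ge3$) if $H$ is isomorphic to an induced subgraph of $B_{i,j,N}$ where $N=2|V(H)|+1$. -}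

module Defs where

open import Data.Nat using (ℕ; zero; suc; _+_; _*_; _∸_; _≡ᵇ_; _≤_)
open import Data.Bool using (Bool; true; false; _∧_; _∨_; not)
open import Data.Bool.Properties using (∨-comm)
open import Data.Fin using (Fin; toℕ; splitAt)
open import Data.Sum using (_⊎_; inj₁; inj₂)
open import Data.Product using (Σ; _×_; _,_)
open import Function.Definitions using (Injective)
open import Relation.Binary.PropositionalEquality using (_≡_; refl; cong; cong₂)

record Graph : Set where
  field
    size       : ℕ
    adj        : Fin size → Fin size → Bool
    adj-sym    : ∀ u v → adj u v ≡ adj v u
    adj-irrefl : ∀ u → adj u u ≡ false

open Graph public

≡ᵇ-sym : ∀ a b → (a ≡ᵇ b) ≡ (b ≡ᵇ a)
≡ᵇ-sym zero zero = refl
≡ᵇ-sym zero (suc b) = refl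
≡ᵇ-sym (suc a) zero = refl
≡ᵇ-sym (suc a) (suc b) = ≡ᵇ-sym a b

≡ᵇ-refl : ∀ a → (a ≡ᵇ a) ≡ true
≡ᵇ-refl zero = refl
≡ᵇ-refl (suc a) = ≡ᵇ-refl a

fromRel : (n : ℕ) → (ℕ → ℕ → Bool) → Graph
fromRel n R = record
  { size = n
  ; adj = A
  ; adj-sym = λ u v → cong₂ _∧_ (cong not (≡ᵇ-sym (toℕ u) (toℕ v)))
                                 (∨-comm (R (toℕ u) (toℕ v)) (R (toℕ v) (toℕ u)))
  ; adj-irrefl = λ u → irr u
  }
  where
  A : Fin n → Fin n → Bool
  A u v = not (toℕ u ≡ᵇ toℕ v) ∧ (R (toℕ u) (toℕ v) ∨ R (toℕ v) (toℕ u))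
  irr : ∀ u → A u u ≡ false
  irr u rewrite ≡ᵇ-refl (toℕ u) = refl

P : ℕ → Graph
P k = fromRel k (λ a b → suc a ≡ᵇ b)

-- Cycle C_r on vertices 0,…,r-1 (edges {a,a+1} and {0,r-1}); used for r ≥ 3.
C : ℕ → Graph
C r = fromRel r (λ a b → (suc a ≡ᵇ b) ∨ ((a ≡ᵇ 0) ∧ (b ≡ᵇ (r ∸ 1))))

-- Disjoint union G + H: vertices of G first (0..|G|-1), then those of H.
module _ (G H : Graph) where
  private
    S = Fin (size G) ⊎ Fin (size H)
    Aₛ : S → S → Bool
    Aₛ (inj₁ x) (inj₁ y) = adj G x y
    Aₛ (inj₂ x) (inj₂ y) = adj H x y
    Aₛ (inj₁ x) (inj₂ y) = false
    Aₛ (inj₂ x) (inj₁ y) = false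
    Aₛ-sym : ∀ s t → Aₛ s t ≡ Aₛ t s
    Aₛ-sym (inj₁ x) (inj₁ y) = adj-sym G x y
    Aₛ-sym (inj₂ x) (inj₂ y) = adj-sym H x y
    Aₛ-sym (inj₁ x) (inj₂ y) = refl
    Aₛ-sym (inj₂ x) (inj₁ y) = refl
    Aₛ-irr : ∀ s → Aₛ s s ≡ false
    Aₛ-irr (inj₁ x) = adj-irrefl G x
    Aₛ-irr (inj₂ x) = adj-irrefl H x

  infixl 6 _⊕_
  _⊕_ : Graph
  _⊕_ = record
    { size = size G + size H
    ; adj = λ u v → Aₛ (splitAt (size G) u) (splitAt (size G) v)
    ; adj-sym = λ u v → Aₛ-sym (splitAt (size G) u) (splitAt (size G) v)
    ; adj-irrefl = λ u → Aₛ-irr (splitAt (size G) u)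
    }

-- Add the edge between the vertices with indices a and b (if a ≠ b and both exist).
addEdge : (G : Graph) → ℕ → ℕ → Graph
addEdge G a b = record
  { size = size G
  ; adj = A
  ; adj-sym = λ u v → cong₂ _∨_ (adj-sym G u v)
                        (cong₂ _∧_ (cong not (≡ᵇ-sym (toℕ u) (toℕ v))) (∨-comm (hit u v) (hit v u)))
  ; adj-irrefl = irr
  }
  where
  hit : Fin (size G) → Fin (size G) → Bool
  hit u v = (toℕ u ≡ᵇ a) ∧ (toℕ v ≡ᵇ b)
  A : Fin (size G) → Fin (size G) → Bool
  A u v = adj G u v ∨ (not (toℕ u ≡ᵇ toℕ v) ∧ (hit u v ∨ hit v u))
  irr : ∀ u → A u u ≡ false
  irr u rewrite adj-irrefl G u | ≡ᵇ-refl (toℕ u) = refl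

-- D^r_k : C_r (vertices 0..r-1) + P_k (vertices r..r+k-1), plus the edge
-- between cycle vertex 0 and path end-vertex r.  D^r_0 = C_r.
D : (r k : ℕ) → Graph
D r zero    = C r
D r (suc k) = addEdge (C r ⊕ P (suc k)) 0 r

-- Butterfly⁺ i j m = B_{i,j,m+1}: cycles C_i (vertices 0..i-1, x = 0) and
-- C_j (vertices i..i+j-1, y = i) joined by a path with m+1 edges between x and y
-- (internal path vertices i+j, …, i+j+m-1).
Butterfly⁺ : (i j m : ℕ) → Graph
Butterfly⁺ i j zero    = addEdge (C i ⊕ C j) 0 i
Butterfly⁺ i j (suc m) =
  addEdge (addEdge (C i ⊕ C j ⊕ P (suc m)) 0 (i + j)) (i + j + m) i

_⊑_ : Graph → Graph → Set
H ⊑ G = Σ (Fin (size H) → Fin (size G)) λ f →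
          Injective _≡_ _≡_ f × (∀ u v → adj H u v ≡ adj G (f u) (f v))

-- H covers (i,j): H is an induced subgraph of B_{i,j,N}, N = 2|V(H)|+1.
Covers : Graph → ℕ → ℕ → Set
Covers H i j = H ⊑ Butterfly⁺ i j (2 * size H)

module Submission where

-- (ii) A cycle in a graph on ℕ cannot cross a cut carried by a single edge
-- (`CycleIn.one-side`), cannot lie in a path (`not-in-path`), and inside a region
-- inducing a cycle C_L it fills the region, so its length is L (`InCycleRegion`).
-- Hence every cycle of the butterfly is C_i or C_j, and the disjoint cycles C_p, C_q
-- of an embedded D^p_k + D^q_k force {i,j} = {p,q} (`EmbeddedCycles`).
--
-- (i) For H ⊆ D^p_k + D^q_k we map the cycles onto C_p, C_q of B_{p,q,2|H|} and the
-- two tails onto the path from its two ends, after shrinking every run of unused tail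
-- vertices to length one (`Compression`, `PathMap`).  Double counting bounds the
-- compressed tails by 2|H| path vertices, so they stay apart (`TailCompression`).

open import Defs
open import Data.Nat
  using (ℕ; zero; suc; _+_; _*_; _∸_; _≡ᵇ_; _<ᵇ_; _≤_; _<_; z≤n; s≤s; _≤?_; _<?_; _≟_; s≤s⁻¹)
open import Data.Nat.Properties
open import Data.Bool using (Bool; true; false; _∧_; _∨_; not; if_then_else_; T)
open import Data.Bool.Properties using (∨-zeroʳ; ∨-identityʳ; ∧-zeroʳ; ∨-comm; not-¬; ¬-not)
import Data.Bool.Properties as Bool
open import Data.Empty using (⊥; ⊥-elim)
open import Data.Unit using (⊤; tt)
open import Data.Fin using (Fin; toℕ; fromℕ<; splitAt; _↑ˡ_; _↑ʳ_)
import Data.Fin.Properties as Fin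
open import Data.Product using (Σ; ∃; _×_; _,_; proj₁; proj₂)
open import Data.Sum using (_⊎_; inj₁; inj₂; swap)
open import Relation.Nullary using (yes; no)
open import Relation.Binary.Definitions using (tri<; tri≈; tri>)
open import Function using (_∘_)
open import Algebra.Properties.CommutativeSemigroup +-commutativeSemigroup using (interchange)
open import Algebra.Properties.CommutativeMonoid.Sum +-0-commutativeMonoid
  using (sum; ∑-distrib-+; sum-replicate-zero)
open import Relation.Binary.PropositionalEquality
  using (_≡_; _≢_; refl; sym; trans; cong; cong₂; subst; subst₂; module ≡-Reasoning)

false≢true : false ≢ true
false≢true ()

≡true⇒T : ∀ {b} → b ≡ true → T b
≡true⇒T refl = tt

T⇒≡true : ∀ {b} → T b → b ≡ true
T⇒≡true {true} _ = refl

≡ᵇ-true⇒≡ : ∀ {a b} → (a ≡ᵇ b) ≡ true → a ≡ b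
≡ᵇ-true⇒≡ {a} {b} e = ≡ᵇ⇒≡ a b (≡true⇒T e)

≡⇒≡ᵇ-true : ∀ {a b} → a ≡ b → (a ≡ᵇ b) ≡ true
≡⇒≡ᵇ-true {a} {b} e = T⇒≡true (≡⇒≡ᵇ a b e)

≢⇒≡ᵇ-false : ∀ {a b} → a ≢ b → (a ≡ᵇ b) ≡ false
≢⇒≡ᵇ-false {a} {b} a≢b with a ≡ᵇ b in e
... | true  = ⊥-elim (a≢b (≡ᵇ-true⇒≡ e))
... | false = refl

≡ᵇ-false⇒≢ : ∀ {a b} → (a ≡ᵇ b) ≡ false → a ≢ b
≡ᵇ-false⇒≢ {a} e refl = false≢true (trans (sym e) (≡⇒≡ᵇ-true {a} refl))

<ᵇ-true⇒< : ∀ {a b} → (a <ᵇ b) ≡ true → a < b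
<ᵇ-true⇒< {a} {b} e = <ᵇ⇒< a b (≡true⇒T e)

<⇒<ᵇ-true : ∀ {a b} → a < b → (a <ᵇ b) ≡ true
<⇒<ᵇ-true a<b = T⇒≡true (<⇒<ᵇ a<b)

<ᵇ-false⇒≥ : ∀ {a b} → (a <ᵇ b) ≡ false → b ≤ a
<ᵇ-false⇒≥ e = ≮⇒≥ (λ a<b → false≢true (trans (sym e) (<⇒<ᵇ-true a<b)))

≥⇒<ᵇ-false : ∀ {a b} → b ≤ a → (a <ᵇ b) ≡ false
≥⇒<ᵇ-false {a} {b} b≤a with a <ᵇ b in e
... | true  = ⊥-elim (<⇒≱ (<ᵇ-true⇒< e) b≤a)
... | false = refl

∨-true : ∀ x y → (x ∨ y) ≡ true → x ≡ true ⊎ y ≡ true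
∨-true true  y _ = inj₁ refl
∨-true false y e = inj₂ e

∨-trueˡ : ∀ {x y} → x ≡ true → (x ∨ y) ≡ true
∨-trueˡ refl = refl

∧-true : ∀ x y → (x ∧ y) ≡ true → x ≡ true × y ≡ true
∧-true true y e = refl , e

IndexRel : Set
IndexRel = ℕ → ℕ → Bool

Represents : Graph → IndexRel → Set
Represents G R = ∀ u v → adj G u v ≡ R (toℕ u) (toℕ v)

symClosure : IndexRel → IndexRel
symClosure R a b = not (a ≡ᵇ b) ∧ (R a b ∨ R b a)

unionRel : ℕ → IndexRel → IndexRel → IndexRel
unionRel s R R' a b =
  if a <ᵇ s then (if b <ᵇ s then R a b else false)
            else (if b <ᵇ s then false else R' (a ∸ s) (b ∸ s))

withEdge : IndexRel → ℕ → ℕ → IndexRel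
withEdge R x y a b = R a b ∨ (not (a ≡ᵇ b) ∧ (((a ≡ᵇ x) ∧ (b ≡ᵇ y)) ∨ ((b ≡ᵇ x) ∧ (a ≡ᵇ y))))

cycleRel : ℕ → IndexRel
cycleRel r = symClosure (λ a b → (suc a ≡ᵇ b) ∨ ((a ≡ᵇ 0) ∧ (b ≡ᵇ (r ∸ 1))))

pathRel : IndexRel
pathRel = symClosure (λ a b → suc a ≡ᵇ b)

DRel : ℕ → ℕ → IndexRel
DRel r zero    = cycleRel r
DRel r (suc k) = withEdge (unionRel r (cycleRel r) pathRel) 0 r

butterflyRel : ℕ → ℕ → ℕ → IndexRel
butterflyRel i j zero    = withEdge (unionRel i (cycleRel i) (cycleRel j)) 0 i
butterflyRel i j (suc m) =
  withEdge (withEdge (unionRel (i + j) (unionRel i (cycleRel i) (cycleRel j)) pathRel) 0 (i + j))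
           (i + j + m) i

splitView : ∀ m n (u : Fin (m + n)) →
            (Σ (Fin m) λ x → u ≡ x ↑ˡ n) ⊎ (Σ (Fin n) λ y → u ≡ m ↑ʳ y)
splitView m n u with splitAt m u in eq
... | inj₁ x = inj₁ (x , sym (Fin.splitAt⁻¹-↑ˡ eq))
... | inj₂ y = inj₂ (y , sym (Fin.splitAt⁻¹-↑ʳ eq))

module _ {s : ℕ} {R R' : IndexRel} {a b : ℕ} where
  unionRel-ll : a < s → b < s → unionRel s R R' a b ≡ R a b
  unionRel-ll a<s b<s rewrite <⇒<ᵇ-true a<s | <⇒<ᵇ-true b<s = refl

  unionRel-lr : a < s → s ≤ b → unionRel s R R' a b ≡ false
  unionRel-lr a<s s≤b rewrite <⇒<ᵇ-true a<s | ≥⇒<ᵇ-false s≤b = refl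

  unionRel-rl : s ≤ a → b < s → unionRel s R R' a b ≡ false
  unionRel-rl s≤a b<s rewrite ≥⇒<ᵇ-false s≤a | <⇒<ᵇ-true b<s = refl

  unionRel-rr : s ≤ a → s ≤ b → unionRel s R R' a b ≡ R' (a ∸ s) (b ∸ s)
  unionRel-rr s≤a s≤b rewrite ≥⇒<ᵇ-false s≤a | ≥⇒<ᵇ-false s≤b = refl

unionRel-shift : ∀ {s R R'} x y → unionRel s R R' (s + x) (s + y) ≡ R' x y
unionRel-shift {s} {R} {R'} x y =
  trans (unionRel-rr {s} {R} {R'} (m≤m+n s x) (m≤m+n s y)) (cong₂ R' (m+n∸m≡n s x) (m+n∸m≡n s y))

represents-⊕ : ∀ {G G'} R R' → Represents G R → Represents G' R' →
               Represents (G ⊕ G') (unionRel (size G) R R')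
represents-⊕ {G} {G'} R R' rep rep' u v
  with splitView (size G) (size G') u | splitView (size G) (size G') v
... | inj₁ (x , refl) | inj₁ (y , refl)
  rewrite Fin.splitAt-↑ˡ (size G) x (size G') | Fin.splitAt-↑ˡ (size G) y (size G')
        | Fin.toℕ-↑ˡ x (size G') | Fin.toℕ-↑ˡ y (size G') =
  trans (rep x y) (sym (unionRel-ll {size G} {R} {R'} (Fin.toℕ<n x) (Fin.toℕ<n y)))
... | inj₁ (x , refl) | inj₂ (y , refl)
  rewrite Fin.splitAt-↑ˡ (size G) x (size G') | Fin.splitAt-↑ʳ (size G) (size G') y
        | Fin.toℕ-↑ˡ x (size G') | Fin.toℕ-↑ʳ (size G) y =
  sym (unionRel-lr {size G} {R} {R'} (Fin.toℕ<n x) (m≤m+n (size G) (toℕ y)))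
... | inj₂ (x , refl) | inj₁ (y , refl)
  rewrite Fin.splitAt-↑ʳ (size G) (size G') x | Fin.splitAt-↑ˡ (size G) y (size G')
        | Fin.toℕ-↑ʳ (size G) x | Fin.toℕ-↑ˡ y (size G') =
  sym (unionRel-rl {size G} {R} {R'} (m≤m+n (size G) (toℕ x)) (Fin.toℕ<n y))
... | inj₂ (x , refl) | inj₂ (y , refl)
  rewrite Fin.splitAt-↑ʳ (size G) (size G') x | Fin.splitAt-↑ʳ (size G) (size G') y
        | Fin.toℕ-↑ʳ (size G) x | Fin.toℕ-↑ʳ (size G) y =
  trans (rep' x y) (sym (unionRel-shift {size G} {R} {R'} (toℕ x) (toℕ y)))

represents-addEdge : ∀ {G} R x y → Represents G R → Represents (addEdge G x y) (withEdge R x y)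
represents-addEdge R x y rep u v rewrite rep u v = refl

represents-C : ∀ r → Represents (C r) (cycleRel r)
represents-C r u v = refl

represents-P : ∀ k → Represents (P k) pathRel
represents-P k u v = refl

represents-D : ∀ r k → Represents (D r k) (DRel r k)
represents-D r zero    = represents-C r
represents-D r (suc k) =
  represents-addEdge {C r ⊕ P (suc k)} (unionRel r (cycleRel r) pathRel) 0 r
    (represents-⊕ (cycleRel r) pathRel (represents-C r) (represents-P (suc k)))

represents-butterfly : ∀ i j m → Represents (Butterfly⁺ i j m) (butterflyRel i j m)
represents-butterfly i j zero =
  represents-addEdge {C i ⊕ C j} (unionRel i (cycleRel i) (cycleRel j)) 0 i
    (represents-⊕ (cycleRel i) (cycleRel j) (represents-C i) (represents-C j))
represents-butterfly i j (suc m) =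
  represents-addEdge {addEdge (C i ⊕ C j ⊕ P (suc m)) 0 (i + j)} (withEdge pathPart 0 (i + j)) (i + j + m) i
    (represents-addEdge {C i ⊕ C j ⊕ P (suc m)} pathPart 0 (i + j)
      (represents-⊕ (unionRel i (cycleRel i) (cycleRel j)) pathRel
        (represents-⊕ (cycleRel i) (cycleRel j) (represents-C i) (represents-C j)) (represents-P (suc m))))
  where
  pathPart : IndexRel
  pathPart = unionRel (i + j) (unionRel i (cycleRel i) (cycleRel j)) pathRel

DDRel : ℕ → ℕ → ℕ → IndexRel
DDRel p q k = unionRel (size (D p k)) (DRel p k) (DRel q k)

represents-DD : ∀ p q k → Represents (D p k ⊕ D q k) (DDRel p q k)
represents-DD p q k = represents-⊕ (DRel p k) (DRel q k) (represents-D p k) (represents-D q k)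

represents-sym : ∀ {G R} → Represents G R → ∀ {a b} → a < size G → b < size G → R a b ≡ R b a
represents-sym {G} {R} rep {a} {b} a< b< =
  trans (sym (cong₂ R (Fin.toℕ-fromℕ< a<) (Fin.toℕ-fromℕ< b<)))
  (trans (sym (rep (fromℕ< a<) (fromℕ< b<)))
  (trans (adj-sym G (fromℕ< a<) (fromℕ< b<))
  (trans (rep (fromℕ< b<) (fromℕ< a<)) (cong₂ R (Fin.toℕ-fromℕ< b<) (Fin.toℕ-fromℕ< a<)))))

size-D : ∀ r k → size (D r k) ≡ r + k
size-D r zero    = sym (+-identityʳ r)
size-D r (suc k) = refl

r≤size-D : ∀ r k → r ≤ size (D r k)
r≤size-D r k = subst (r ≤_) (sym (size-D r k)) (m≤m+n r k)

Neighbours : ℕ → ℕ → Set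
Neighbours a b = suc a ≡ b ⊎ suc b ≡ a

CycleAdj : ℕ → ℕ → ℕ → ℕ → Set
CycleAdj o L a b = Neighbours a b ⊎ ((a ≡ o × b ≡ o + L ∸ 1) ⊎ (b ≡ o × a ≡ o + L ∸ 1))

symClosure-sym : ∀ R a b → symClosure R a b ≡ symClosure R b a
symClosure-sym R a b = cong₂ _∧_ (cong not (≡ᵇ-sym a b)) (∨-comm (R a b) (R b a))

pairTest-false : ∀ {a b x y} → (a ≡ x → b ≡ y → ⊥) → ((a ≡ᵇ x) ∧ (b ≡ᵇ y)) ≡ false
pairTest-false {a} {b} {x} {y} h with a ≡ᵇ x in e
... | false = refl
... | true  = ≢⇒≡ᵇ-false (h (≡ᵇ-true⇒≡ e))

withEdge-other : ∀ {R x y a b} → (a ≡ x → b ≡ y → ⊥) → (b ≡ x → a ≡ y → ⊥) →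
                 withEdge R x y a b ≡ R a b
withEdge-other {R} {x} {y} {a} {b} h₁ h₂
  rewrite pairTest-false {a} {b} {x} {y} h₁ | pairTest-false {b} {a} {x} {y} h₂
        | ∧-zeroʳ (not (a ≡ᵇ b)) = ∨-identityʳ (R a b)

withEdge-new : ∀ {R x y a b} → a ≢ b → a ≡ x → b ≡ y → withEdge R x y a b ≡ true
withEdge-new {R} {a = a} {b} a≢b refl refl
  rewrite ≢⇒≡ᵇ-false a≢b | ≡⇒≡ᵇ-true {a} refl | ≡⇒≡ᵇ-true {b} refl = ∨-zeroʳ (R a b)

withEdge-new′ : ∀ {R x y a b} → a ≢ b → b ≡ x → a ≡ y → withEdge R x y a b ≡ true
withEdge-new′ {R} {a = a} {b} a≢b refl refl
  rewrite ≢⇒≡ᵇ-false a≢b | ≡⇒≡ᵇ-true {a} refl | ≡⇒≡ᵇ-true {b} refl = ∨-zeroʳ (R a b)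

cycleGen-true : ∀ r a b → ((suc a ≡ᵇ b) ∨ ((a ≡ᵇ 0) ∧ (b ≡ᵇ (r ∸ 1)))) ≡ true →
                suc a ≡ b ⊎ (a ≡ 0 × b ≡ r ∸ 1)
cycleGen-true r a b e with ∨-true (suc a ≡ᵇ b) _ e
... | inj₁ e₁ = inj₁ (≡ᵇ-true⇒≡ e₁)
... | inj₂ e₂ = let (e₃ , e₄) = ∧-true (a ≡ᵇ 0) _ e₂ in inj₂ (≡ᵇ-true⇒≡ e₃ , ≡ᵇ-true⇒≡ e₄)

cycleRel-true : ∀ r a b → cycleRel r a b ≡ true → CycleAdj 0 r a b
cycleRel-true r a b e with ∨-true _ _ (proj₂ (∧-true (not (a ≡ᵇ b)) _ e))
... | inj₁ e₁ with cycleGen-true r a b e₁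
...   | inj₁ s = inj₁ (inj₁ s)
...   | inj₂ w = inj₂ (inj₁ w)
cycleRel-true r a b e | inj₂ e₂ with cycleGen-true r b a e₂
...   | inj₁ s = inj₁ (inj₂ s)
...   | inj₂ w = inj₂ (inj₂ w)

pathRel-true : ∀ a b → pathRel a b ≡ true → Neighbours a b
pathRel-true a b e with ∨-true (suc a ≡ᵇ b) _ (proj₂ (∧-true (not (a ≡ᵇ b)) _ e))
... | inj₁ e₁ = inj₁ (≡ᵇ-true⇒≡ e₁)
... | inj₂ e₂ = inj₂ (≡ᵇ-true⇒≡ e₂)

n≢1+n : ∀ n → n ≢ suc n
n≢1+n n ()

cycleRel-succ : ∀ r t → cycleRel r t (suc t) ≡ true
cycleRel-succ r t rewrite ≢⇒≡ᵇ-false (n≢1+n t) | ≡⇒≡ᵇ-true {suc t} refl = refl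

cycleRel-wrap : ∀ r → 3 ≤ r → cycleRel r (r ∸ 1) 0 ≡ true
cycleRel-wrap (suc (suc (suc r))) (s≤s (s≤s (s≤s _))) rewrite ≡⇒≡ᵇ-true {r} refl = refl

pathRel-succ : ∀ a → pathRel a (suc a) ≡ true
pathRel-succ a rewrite ≢⇒≡ᵇ-false (n≢1+n a) | ≡⇒≡ᵇ-true {suc a} refl = refl

pathRel-refl : ∀ a → pathRel a a ≡ false
pathRel-refl a rewrite ≡⇒≡ᵇ-true {a} refl = refl

pathRel-sym : ∀ a b → pathRel a b ≡ pathRel b a
pathRel-sym = symClosure-sym (λ a b → suc a ≡ᵇ b)

pathRel-far : ∀ {a b} → suc (suc a) ≤ b → pathRel a b ≡ false
pathRel-far {a} {b} a+2≤b
  rewrite ≢⇒≡ᵇ-false {suc a} {b} (λ e → <-irrefl e a+2≤b)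
        | ≢⇒≡ᵇ-false {suc b} {a} (λ e → 1+n≰n (≤-trans (≤-trans (n≤1+n (suc a)) a+2≤b)
                                                          (≤-trans (n≤1+n b) (≤-reflexive e))))
  = ∧-zeroʳ _

3≤⇒0< : ∀ {r} → 3 ≤ r → 0 < r
3≤⇒0< r≥3 = ≤-trans (s≤s z≤n) r≥3

r-1≢1 : ∀ {r} → 3 ≤ r → r ∸ 1 ≢ 1
r-1≢1 (s≤s (s≤s (s≤s _))) ()

r-1≢0 : ∀ {r} → 3 ≤ r → r ∸ 1 ≢ 0
r-1≢0 (s≤s (s≤s (s≤s _))) ()

last-index : ∀ {t n} → t < n → t ≤ n ∸ 1
last-index (s≤s t≤n) = t≤n

pred< : ∀ {n} → 0 < n → n ∸ 1 < n
pred< {suc n} _ = n<1+n n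

separated : ∀ {a n b} → a < n → n ≤ b → a ≢ b
separated a<n n≤b refl = <-irrefl refl (<-≤-trans a<n n≤b)

i≤i+j+m : ∀ i j m → i ≤ i + j + m
i≤i+j+m i j m = ≤-trans (m≤m+n i j) (m≤m+n (i + j) m)

module ButterflyTable (i j m : ℕ) (i>0 : 0 < i) (j>0 : 0 < j) where
  B : IndexRel
  B = butterflyRel i j (suc m)

  -- The butterfly is built in three layers: the two cycles, then the path beside
  -- them, then the two bridges; each lemma peels the bridges off and reads a block.
  private
    Cycles : IndexRel
    Cycles = unionRel i (cycleRel i) (cycleRel j)

    Unjoined : IndexRel
    Unjoined = unionRel (i + j) Cycles pathRel

    Joined : IndexRel
    Joined = withEdge Unjoined 0 (i + j)

    outer : ∀ {a b} → (a ≡ i + j + m → b ≡ i → ⊥) → (b ≡ i + j + m → a ≡ i → ⊥) →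
            B a b ≡ Joined a b
    outer = withEdge-other {Joined}

    inner : ∀ {a b} → (a ≡ 0 → b ≡ i + j → ⊥) → (b ≡ 0 → a ≡ i + j → ⊥) →
            Joined a b ≡ Unjoined a b
    inner = withEdge-other {Unjoined}

    pathVertex≢0 : ∀ {s} → i + j + s ≢ 0
    pathVertex≢0 {s} e = separated (≤-trans j>0 (m≤n+m j i)) (m≤m+n (i + j) s) (sym e)

  cycleᵢ : ∀ {a a'} → a < i → a' < i → B a a' ≡ cycleRel i a a'
  cycleᵢ {a} {a'} a< a'< =
    trans (outer (λ e _ → separated a< (i≤i+j+m i j m) e) (λ _ e → separated a< ≤-refl e))
    (trans (inner (λ _ e → separated a'< (m≤m+n i j) e) (λ _ e → separated a< (m≤m+n i j) e))
    (trans (unionRel-ll {i + j} {Cycles} {pathRel} (<-≤-trans a< (m≤m+n i j)) (<-≤-trans a'< (m≤m+n i j)))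
      (unionRel-ll {i} {cycleRel i} {cycleRel j} a< a'<)))

  cycleⱼ : ∀ {b b'} → b < j → b' < j → B (i + b) (i + b') ≡ cycleRel j b b'
  cycleⱼ {b} {b'} b< b'< =
    trans (outer (λ e _ → separated (+-monoʳ-< i b<) (m≤m+n (i + j) m) e)
                 (λ e _ → separated (+-monoʳ-< i b'<) (m≤m+n (i + j) m) e))
    (trans (inner (λ _ e → separated (+-monoʳ-< i b'<) ≤-refl e) (λ _ e → separated (+-monoʳ-< i b<) ≤-refl e))
    (trans (unionRel-ll {i + j} {Cycles} {pathRel} (+-monoʳ-< i b<) (+-monoʳ-< i b'<))
      (unionRel-shift {i} {cycleRel i} {cycleRel j} b b')))

  path : ∀ {s s'} → B (i + j + s) (i + j + s') ≡ pathRel s s'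
  path {s} {s'} =
    trans (outer (λ _ e → separated (m<m+n i j>0) (m≤m+n (i + j) s') (sym e))
                 (λ _ e → separated (m<m+n i j>0) (m≤m+n (i + j) s) (sym e)))
    (trans (inner (λ e _ → pathVertex≢0 e) (λ e _ → pathVertex≢0 e))
      (unionRel-shift {i + j} {Cycles} {pathRel} s s'))

  cycleᵢ-cycleⱼ : ∀ {a b} → a < i → b < j → B a (i + b) ≡ false
  cycleᵢ-cycleⱼ {a} {b} a< b< =
    trans (outer (λ e _ → separated a< (i≤i+j+m i j m) e) (λ _ e → separated a< ≤-refl e))
    (trans (inner (λ _ e → separated (+-monoʳ-< i b<) ≤-refl e) (λ _ e → separated a< (m≤m+n i j) e))
    (trans (unionRel-ll {i + j} {Cycles} {pathRel} (<-≤-trans a< (m≤m+n i j)) (+-monoʳ-< i b<))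
      (unionRel-lr {i} {cycleRel i} {cycleRel j} a< (m≤m+n i b))))

  cycleᵢ-path : ∀ {a s} → a < i → B a (i + j + s) ≡ ((a ≡ᵇ 0) ∧ (s ≡ᵇ 0))
  cycleᵢ-path {a} {s} a< with a ≟ 0 | s ≟ 0
  ... | yes refl | yes refl =
    ∨-trueˡ (withEdge-new {Unjoined} (λ e → pathVertex≢0 (sym e)) refl (+-identityʳ (i + j)))
  ... | yes refl | no s≢0 =
    trans (outer (λ e _ → separated a< (i≤i+j+m i j m) e) (λ _ e → separated a< ≤-refl e))
    (trans (inner (λ _ e → s≢0 (+-cancelˡ-≡ (i + j) _ _ (trans e (sym (+-identityʳ (i + j))))))
                  (λ e _ → pathVertex≢0 e))
    (trans (unionRel-lr {i + j} {Cycles} {pathRel} (<-≤-trans a< (m≤m+n i j)) (m≤m+n (i + j) s))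
      (sym (≢⇒≡ᵇ-false s≢0))))
  ... | no a≢0 | _ =
    trans (outer (λ e _ → separated a< (i≤i+j+m i j m) e) (λ _ e → separated a< ≤-refl e))
    (trans (inner (λ e _ → a≢0 e) (λ e _ → pathVertex≢0 e))
    (trans (unionRel-lr {i + j} {Cycles} {pathRel} (<-≤-trans a< (m≤m+n i j)) (m≤m+n (i + j) s))
      (sym (cong (_∧ (s ≡ᵇ 0)) (≢⇒≡ᵇ-false a≢0)))))

  cycleⱼ-path : ∀ {b s} → b < j → B (i + b) (i + j + s) ≡ ((b ≡ᵇ 0) ∧ (s ≡ᵇ m))
  cycleⱼ-path {b} {s} b< with b ≟ 0 | s ≟ m
  ... | yes refl | yes refl rewrite ≡⇒≡ᵇ-true {m} refl =
    withEdge-new′ {Joined} (separated (+-monoʳ-< i b<) (m≤m+n (i + j) m)) refl (+-identityʳ i)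
  ... | yes refl | no s≢m =
    trans (outer (λ e _ → separated (+-monoʳ-< i b<) (m≤m+n (i + j) m) e)
                 (λ e _ → s≢m (+-cancelˡ-≡ (i + j) _ _ e)))
    (trans (inner (λ e _ → separated i>0 (m≤m+n i _) (sym e)) (λ e _ → pathVertex≢0 e))
    (trans (unionRel-lr {i + j} {Cycles} {pathRel} (+-monoʳ-< i b<) (m≤m+n (i + j) s))
      (sym (≢⇒≡ᵇ-false s≢m))))
  ... | no b≢0 | _ =
    trans (outer (λ e _ → separated (+-monoʳ-< i b<) (m≤m+n (i + j) m) e)
                 (λ _ e → b≢0 (+-cancelˡ-≡ i _ _ (trans e (sym (+-identityʳ i))))))
    (trans (inner (λ e _ → separated i>0 (m≤m+n i _) (sym e)) (λ e _ → pathVertex≢0 e))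
    (trans (unionRel-lr {i + j} {Cycles} {pathRel} (+-monoʳ-< i b<) (m≤m+n (i + j) s))
      (sym (cong (_∧ (s ≡ᵇ m)) (≢⇒≡ᵇ-false b≢0)))))

module DTable (r : ℕ) (r>0 : 0 < r) where
  cycle : ∀ k {a a'} → a < r → a' < r → DRel r k a a' ≡ cycleRel r a a'
  cycle zero    a< a'< = refl
  cycle (suc k) {a} {a'} a< a'< =
    trans (withEdge-other {unionRel r (cycleRel r) pathRel}
             (λ _ e → separated a'< ≤-refl e) (λ _ e → separated a< ≤-refl e))
      (unionRel-ll {r} {cycleRel r} {pathRel} a< a'<)

  tail : ∀ k {d d'} → d < k → d' < k → DRel r k (r + d) (r + d') ≡ pathRel d d'
  tail (suc k) {d} {d'} _ _ =
    trans (withEdge-other {unionRel r (cycleRel r) pathRel}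
             (λ e _ → separated r>0 (m≤m+n r d) (sym e)) (λ e _ → separated r>0 (m≤m+n r d') (sym e)))
      (unionRel-shift {r} {cycleRel r} {pathRel} d d')

  cycle-tail : ∀ k {a d} → a < r → d < k → DRel r k a (r + d) ≡ ((a ≡ᵇ 0) ∧ (d ≡ᵇ 0))
  cycle-tail (suc k) {a} {d} a< _ with a ≟ 0 | d ≟ 0
  ... | yes refl | yes refl =
    withEdge-new {unionRel r (cycleRel r) pathRel} (separated r>0 (m≤m+n r 0)) refl (+-identityʳ r)
  ... | yes refl | no d≢0 =
    trans (withEdge-other {unionRel r (cycleRel r) pathRel}
             (λ _ e → d≢0 (+-cancelˡ-≡ r _ _ (trans e (sym (+-identityʳ r)))))
             (λ e _ → separated r>0 (m≤m+n r d) (sym e)))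
      (trans (unionRel-lr {r} {cycleRel r} {pathRel} a< (m≤m+n r d)) (sym (≢⇒≡ᵇ-false d≢0)))
  ... | no a≢0 | _ =
    trans (withEdge-other {unionRel r (cycleRel r) pathRel}
             (λ e _ → a≢0 e) (λ e _ → separated r>0 (m≤m+n r d) (sym e)))
      (trans (unionRel-lr {r} {cycleRel r} {pathRel} a< (m≤m+n r d))
             (sym (cong (_∧ (d ≡ᵇ 0)) (≢⇒≡ᵇ-false a≢0))))

below-suc : ∀ {P : ℕ → Set} {n} → (∀ t → t < n → P t) → P n → ∀ t → t < suc n → P t
below-suc {n = n} all Pn t t<1+n with m≤n⇒m<n∨m≡n (s≤s⁻¹ t<1+n)
... | inj₁ t<n  = all t t<n
... | inj₂ refl = Pn

search : (x : ℕ → Bool) (b : Bool) (n : ℕ) →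
         (∀ t → t < n → x t ≡ b) ⊎ (Σ ℕ λ t → t < n × x t ≡ not b)
search x b zero = inj₁ (λ t ())
search x b (suc n) with search x b n | x n Bool.≟ b
... | inj₂ (t , t<n , e) | _      = inj₂ (t , m≤n⇒m≤1+n t<n , e)
... | inj₁ _            | no x≢b = inj₂ (n , ≤-refl , ¬-not x≢b)
... | inj₁ all          | yes e  = inj₁ (below-suc all e)

switch : (x : ℕ → Bool) → ∀ β a b → a ≤ b → x a ≡ β → x b ≡ not β →
         Σ ℕ λ s → a ≤ s × suc s ≤ b × x s ≡ β × x (suc s) ≡ not β
switch x β a zero z≤n xa xb = ⊥-elim (not-¬ refl (trans (sym xa) xb))
switch x β a (suc b) a≤1+b xa xb with a ≤? b
... | no a≰b with refl ← ≤-antisym a≤1+b (≰⇒> a≰b) = ⊥-elim (not-¬ refl (trans (sym xa) xb))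
... | yes a≤b with x b Bool.≟ β
...   | yes e  = b , a≤b , ≤-refl , e , xb
...   | no x≢β = let (s , a≤s , s<b , xs , xs+1) = switch x β a b a≤b xa (¬-not x≢β)
                 in s , a≤s , m≤n⇒m≤1+n s<b , xs , xs+1

injection-bound : ∀ n m (f : ℕ → ℕ) → (∀ t → t < n → f t < m) →
                  (∀ {t t'} → t < n → t' < n → f t ≡ f t' → t ≡ t') → n ≤ m
injection-bound n m f f< f-inj with n ≤? m
... | yes n≤m = n≤m
... | no n≰m with Fin.pigeonhole (≰⇒> n≰m) F
  where
  F : Fin n → Fin m
  F i = fromℕ< (f< (toℕ i) (Fin.toℕ<n i))
... | (i , j , i<j , Fi≡Fj) = ⊥-elim (<-irrefl (f-inj (Fin.toℕ<n i) (Fin.toℕ<n j) fi≡fj) i<j)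
  where
  fi≡fj : f (toℕ i) ≡ f (toℕ j)
  fi≡fj = trans (sym (Fin.toℕ-fromℕ< (f< (toℕ i) (Fin.toℕ<n i))))
          (trans (cong toℕ Fi≡Fj) (Fin.toℕ-fromℕ< (f< (toℕ j) (Fin.toℕ<n j))))

module CycleIn (E : ℕ → ℕ → Set) (E-sym : ∀ {a b} → E a b → E b a)
               (r : ℕ) (r≥3 : 3 ≤ r) (c : ℕ → ℕ)
               (c-inj : ∀ {t t'} → t < r → t' < r → c t ≡ c t' → t ≡ t')
               (c-step : ∀ {t} → suc t < r → E (c t) (c (suc t)))
               (c-wrap : E (c (r ∸ 1)) (c 0)) where

  r>0 : 0 < r
  r>0 = 3≤⇒0< r≥3

  r-1<r : r ∸ 1 < r
  r-1<r = pred< r>0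

  Step : ℕ → ℕ → Set
  Step u w = suc u ≡ w ⊎ (u ≡ r ∸ 1 × w ≡ 0)

  step-edge : ∀ {u w} → w < r → Step u w → E (c u) (c w)
  step-edge w<r (inj₁ refl)          = c-step w<r
  step-edge _   (inj₂ (refl , refl)) = c-wrap

  -- Since r ≥ 3, the cycle cannot go back and forth along one edge.
  step-asym : ∀ {u w} → Step u w → Step w u → ⊥
  step-asym (inj₁ refl)          (inj₁ e)          = n≢2+n _ (sym e)
    where n≢2+n : ∀ n → n ≢ suc (suc n)
          n≢2+n n ()
  step-asym (inj₁ refl)          (inj₂ (e , refl)) = r-1≢1 r≥3 (sym e)
  step-asym (inj₂ (refl , refl)) (inj₁ e)          = r-1≢1 r≥3 (sym e)
  step-asym (inj₂ (_ , refl))    (inj₂ (e , _))    = r-1≢0 r≥3 (sym e)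

  successor : ∀ t → t < r → Σ ℕ λ w → w < r × Step t w
  successor t t<r with suc t <? r
  ... | yes t+1<r = suc t , t+1<r , inj₁ refl
  ... | no  t+1≮r = 0 , r>0 , inj₂ (cong (_∸ 1) (≤-antisym t<r (≮⇒≥ t+1≮r)) , refl)

  predecessor : ∀ t → t < r → Σ ℕ λ u → u < r × Step u t
  predecessor zero    _     = r ∸ 1 , r-1<r , inj₂ (refl , refl)
  predecessor (suc t) t+1<r = t , <-trans (n<1+n t) t+1<r , inj₁ refl

  record Switch (x : ℕ → Bool) (β : Bool) : Set where
    field
      from to   : ℕ
      from<r    : from < r
      to<r      : to < r
      step      : Step from to
      from-β    : x from ≡ β
      to-notβ   : x to ≡ not β

  switch-between : ∀ {x β a b} → b < r → (Σ ℕ λ s → a ≤ s × suc s ≤ b × x s ≡ β × x (suc s) ≡ not β) →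
                   Switch x β
  switch-between b<r (s , _ , s<b , xs , xs+1) =
    record { from = s ; to = suc s ; from<r = <-trans s<b b<r ; to<r = ≤-<-trans s<b b<r
           ; step = inj₁ refl ; from-β = xs ; to-notβ = xs+1 }

  -- A labelling of the cycle that takes both values switches (in either direction):
  -- between the two indices, or else across the closing edge from r-1 to 0.
  switch-on-cycle : (x : ℕ → Bool) → ∀ β t₁ t₂ → t₁ < r → t₂ < r → x t₁ ≡ β → x t₂ ≡ not β →
                    Switch x β
  switch-on-cycle x β t₁ t₂ t₁<r t₂<r x₁ x₂ with t₁ ≤? t₂
  ... | yes t₁≤t₂ = switch-between t₂<r (switch x β t₁ t₂ t₁≤t₂ x₁ x₂)
  ... | no _ with x (r ∸ 1) Bool.≟ β | x 0 Bool.≟ β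
  ...   | no x≢β | _ = switch-between r-1<r (switch x β t₁ (r ∸ 1) (last-index t₁<r) x₁ (¬-not x≢β))
  ...   | yes e | no x₀≢β =
    record { from = r ∸ 1 ; to = 0 ; from<r = r-1<r ; to<r = r>0
           ; step = inj₂ (refl , refl) ; from-β = e ; to-notβ = ¬-not x₀≢β }
  ...   | yes _ | yes e₀ = switch-between t₂<r (switch x β 0 t₂ z≤n e₀ x₂)

  -- Then the cycle lies
  -- on one side: crossing over and coming back would use α–β in both directions.
  one-side : (Z : ℕ → Set) → (∀ t → t < r → Z (c t)) → (X : ℕ → Bool) → (α β : ℕ) →
             (∀ a b → Z a → Z b → E a b → X a ≡ true → X b ≡ false → a ≡ α × b ≡ β) →
             (∀ t → t < r → X (c t) ≡ true) ⊎ (∀ t → t < r → X (c t) ≡ false)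
  one-side Z inZ X α β only-α-β with search (X ∘ c) true r
  ... | inj₁ allX = inj₁ allX
  ... | inj₂ (t₁ , t₁<r , X₁) with search (X ∘ c) false r
  ...   | inj₁ noneX = inj₂ noneX
  ...   | inj₂ (t₂ , t₂<r , X₂) =
    ⊥-elim (step-asym (Switch.step out) (subst₂ Step back-from≡out-to back-to≡out-from (Switch.step back)))
    where
    out : Switch (X ∘ c) true
    out = switch-on-cycle (X ∘ c) true t₂ t₁ t₂<r t₁<r X₂ X₁
    back : Switch (X ∘ c) false
    back = switch-on-cycle (X ∘ c) false t₁ t₂ t₁<r t₂<r X₁ X₂
    out-crossing : c (Switch.from out) ≡ α × c (Switch.to out) ≡ β
    out-crossing = only-α-β _ _ (inZ _ (Switch.from<r out)) (inZ _ (Switch.to<r out))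
                     (step-edge (Switch.to<r out) (Switch.step out)) (Switch.from-β out) (Switch.to-notβ out)
    back-crossing : c (Switch.to back) ≡ α × c (Switch.from back) ≡ β
    back-crossing = only-α-β _ _ (inZ _ (Switch.to<r back)) (inZ _ (Switch.from<r back))
                      (E-sym (step-edge (Switch.to<r back) (Switch.step back))) (Switch.to-notβ back) (Switch.from-β back)
    back-to≡out-from : Switch.to back ≡ Switch.from out
    back-to≡out-from =
      c-inj (Switch.to<r back) (Switch.from<r out) (trans (proj₁ back-crossing) (sym (proj₁ out-crossing)))
    back-from≡out-to : Switch.from back ≡ Switch.to out
    back-from≡out-to =
      c-inj (Switch.from<r back) (Switch.to<r out) (trans (proj₂ back-crossing) (sym (proj₂ out-crossing)))

  argmax : Σ ℕ λ t → t < r × (∀ t' → t' < r → c t' ≤ c t)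
  argmax = go r r>0
    where
    go : ∀ n → 0 < n → Σ ℕ λ t → t < n × (∀ t' → t' < n → c t' ≤ c t)
    go (suc zero) _ = 0 , s≤s z≤n , below-suc (λ _ ()) ≤-refl
    go (suc (suc n)) _ with go (suc n) (s≤s z≤n)
    ... | t , t<n , max with c (suc n) ≤? c t
    ...   | yes ≤max = t , m≤n⇒m≤1+n t<n , below-suc max ≤max
    ...   | no  ≰max = suc n , ≤-refl , below-suc (λ t' t'< → ≤-trans (max t' t'<) (<⇒≤ (≰⇒> ≰max))) ≤-refl

  -- A cycle cannot live where all edges of E join consecutive integers: both
  -- cycle-neighbours of the maximal vertex would have to be its predecessor.
  not-in-path : (Z : ℕ → Set) → (∀ t → t < r → Z (c t)) →
                (∀ a b → Z a → Z b → E a b → Neighbours a b) → ⊥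
  not-in-path Z inZ path with argmax
  ... | t , t<r , max with successor t t<r | predecessor t t<r
  ...   | w , w<r , t→w | u , u<r , u→t = step-asym t→w (subst (λ z → Step z t) (sym w≡u) u→t)
    where
    below-max : ∀ {v} → v < r → Neighbours (c t) (c v) → suc (c v) ≡ c t
    below-max v<r (inj₁ e) = ⊥-elim (<-irrefl refl (≤-trans (≤-reflexive e) (max _ v<r)))
    below-max v<r (inj₂ e) = e
    w≡u : w ≡ u
    w≡u = c-inj w<r u<r (suc-injective (trans
            (below-max w<r (path _ _ (inZ t t<r) (inZ w w<r) (step-edge w<r t→w)))
            (sym (below-max u<r (swap (path _ _ (inZ u u<r) (inZ t t<r) (step-edge t<r u→t)))))))

  module InCycleRegion (o L : ℕ)
           (region-edges : ∀ a b → o ≤ a → a < o + L → o ≤ b → b < o + L → E a b → CycleAdj o L a b)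
           (inside : ∀ t → t < r → o ≤ c t × c t < o + L) where

    -- A region vertex v missed by c would cut C_L into a path, which contains no cycle.
    fills : ∀ v → o ≤ v → v < o + L → Σ ℕ λ t → t < r × c t ≡ v
    fills v o≤v v<o+L with search (λ t → c t ≡ᵇ v) false r
    ... | inj₂ (t , t<r , e) = t , t<r , ≡ᵇ-true⇒≡ e
    ... | inj₁ missed
      with one-side Z (λ t t<r → inside t t<r , ≡ᵇ-false⇒≢ (missed t t<r)) (_<ᵇ v) o (o + L ∸ 1) only-wrap
      where
      Z : ℕ → Set
      Z a = (o ≤ a × a < o + L) × a ≢ v
      only-wrap : ∀ a b → Z a → Z b → E a b → (a <ᵇ v) ≡ true → (b <ᵇ v) ≡ false →
                  a ≡ o × b ≡ o + L ∸ 1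
      only-wrap a b ((o≤a , a<) , _) ((o≤b , b<) , b≢v) Eab a<v b≮v
        with region-edges a b o≤a a< o≤b b< Eab | <ᵇ-true⇒< {a} {v} a<v
           | ≤∧≢⇒< (<ᵇ-false⇒≥ {b} {v} b≮v) (b≢v ∘ sym)
      ... | inj₁ (inj₁ refl)          | a<v′ | v<b = ⊥-elim (<-irrefl refl (≤-<-trans a<v′ v<b))
      ... | inj₁ (inj₂ refl)          | a<v′ | v<b = ⊥-elim (<-asym (<-trans (n<1+n b) a<v′) v<b)
      ... | inj₂ (inj₁ o-wrap)        | _    | _   = o-wrap
      ... | inj₂ (inj₂ (refl , _))    | _    | v<b = ⊥-elim (<-irrefl refl (≤-<-trans o≤v v<b))
    ... | inj₁ all-below = ⊥-elim (not-in-path (λ a → o ≤ a × a < v)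
            (λ t t<r → proj₁ (inside t t<r) , <ᵇ-true⇒< (all-below t t<r)) below-path)
      where
      below-path : ∀ a b → o ≤ a × a < v → o ≤ b × b < v → E a b → Neighbours a b
      below-path a b (o≤a , a<v) (o≤b , b<v) Eab
        with region-edges a b o≤a (<-trans a<v v<o+L) o≤b (<-trans b<v v<o+L) Eab
      ... | inj₁ neighbours           = neighbours
      ... | inj₂ (inj₁ (_ , refl))    = ⊥-elim (<-irrefl refl (<-≤-trans b<v (last-index v<o+L)))
      ... | inj₂ (inj₂ (_ , refl))    = ⊥-elim (<-irrefl refl (<-≤-trans a<v (last-index v<o+L)))
    ... | inj₂ all-above = ⊥-elim (not-in-path (λ a → v < a × a < o + L)
            (λ t t<r → ≤∧≢⇒< (<ᵇ-false⇒≥ (all-above t t<r)) (≡ᵇ-false⇒≢ (missed t t<r) ∘ sym) ,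
                       proj₂ (inside t t<r))
            above-path)
      where
      above-path : ∀ a b → v < a × a < o + L → v < b × b < o + L → E a b → Neighbours a b
      above-path a b (v<a , a<) (v<b , b<) Eab
        with region-edges a b (≤-trans o≤v (<⇒≤ v<a)) a< (≤-trans o≤v (<⇒≤ v<b)) b< Eab
      ... | inj₁ neighbours           = neighbours
      ... | inj₂ (inj₁ (refl , _))    = ⊥-elim (<-irrefl refl (≤-<-trans o≤v v<a))
      ... | inj₂ (inj₂ (refl , _))    = ⊥-elim (<-irrefl refl (≤-<-trans o≤v v<b))

    -- c is a bijection between its indices and the region.
    length≡ : r ≡ L
    length≡ = ≤-antisym (injection-bound r L (λ t → c t ∸ o) offset< offset-inj)
                        (injection-bound L r preimage preimage< preimage-inj)
      where
      offset< : ∀ t → t < r → c t ∸ o < L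
      offset< t t<r =
        +-cancelˡ-< o _ _ (subst (_< o + L) (sym (m+[n∸m]≡n (proj₁ (inside t t<r)))) (proj₂ (inside t t<r)))
      offset-inj : ∀ {t t'} → t < r → t' < r → c t ∸ o ≡ c t' ∸ o → t ≡ t'
      offset-inj t<r t'<r e = c-inj t<r t'<r
        (trans (sym (m+[n∸m]≡n (proj₁ (inside _ t<r)))) (trans (cong (o +_) e) (m+[n∸m]≡n (proj₁ (inside _ t'<r)))))
      preimage : ℕ → ℕ
      preimage v with v <? L
      ... | yes v<L = proj₁ (fills (o + v) (m≤m+n o v) (+-monoʳ-< o v<L))
      ... | no  _   = 0
      preimage-spec : ∀ v → v < L → preimage v < r × c (preimage v) ≡ o + v
      preimage-spec v v<L with v <? L
      ... | yes v<L′ = proj₂ (fills (o + v) (m≤m+n o v) (+-monoʳ-< o v<L′))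
      ... | no  v≮L  = ⊥-elim (v≮L v<L)
      preimage< : ∀ v → v < L → preimage v < r
      preimage< v v<L = proj₁ (preimage-spec v v<L)
      preimage-inj : ∀ {v v'} → v < L → v' < L → preimage v ≡ preimage v' → v ≡ v'
      preimage-inj v<L v'<L e = +-cancelˡ-≡ o _ _
        (trans (sym (proj₂ (preimage-spec _ v<L))) (trans (cong c e) (proj₂ (preimage-spec _ v'<L))))

shift-view : ∀ {o L a} → o ≤ a → a < o + L → Σ ℕ λ a' → a' < L × a ≡ o + a'
shift-view {o} {L} {a} o≤a a<o+L =
  a ∸ o , +-cancelˡ-< o _ _ (subst (_< o + L) a≡ a<o+L) , a≡
  where
  a≡ : a ≡ o + (a ∸ o)
  a≡ = sym (m+[n∸m]≡n o≤a)

neighbours-shift : ∀ o {a b} → Neighbours a b → Neighbours (o + a) (o + b)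
neighbours-shift o {a} (inj₁ refl) = inj₁ (sym (+-suc o a))
neighbours-shift o {b = b} (inj₂ refl) = inj₂ (sym (+-suc o b))

cycleAdj-shift : ∀ o {L a b} → 0 < L → CycleAdj 0 L a b → CycleAdj o L (o + a) (o + b)
cycleAdj-shift o L>0 (inj₁ n)                 = inj₁ (neighbours-shift o n)
cycleAdj-shift o L>0 (inj₂ (inj₁ (refl , refl))) = inj₂ (inj₁ (+-identityʳ o , sym (+-∸-assoc o L>0)))
cycleAdj-shift o L>0 (inj₂ (inj₂ (refl , refl))) = inj₂ (inj₂ (+-identityʳ o , sym (+-∸-assoc o L>0)))

-- Every cycle of the butterfly B_{i,j,m+1} is one of its two cycles C_i, C_j: the
-- path and the bridges to it carry no cycle, and a cycle inside C_i or C_j fills it.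
module CyclesOfButterfly (i j m : ℕ) (i≥3 : 3 ≤ i) (j≥3 : 3 ≤ j) where
  i>0 : 0 < i
  i>0 = 3≤⇒0< i≥3

  j>0 : 0 < j
  j>0 = 3≤⇒0< j≥3

  open ButterflyTable i j m i>0 j>0

  Edge : ℕ → ℕ → Set
  Edge a b = (a < size (Butterfly⁺ i j (suc m)) × b < size (Butterfly⁺ i j (suc m))) × B a b ≡ true

  Edge-sym : ∀ {a b} → Edge a b → Edge b a
  Edge-sym ((a< , b<) , e) =
    (b< , a<) , trans (sym (represents-sym {Butterfly⁺ i j (suc m)} (represents-butterfly i j (suc m)) a< b<)) e

  data Vertex : ℕ → Set where
    cycleᵢ-vertex : ∀ a → a < i → Vertex a
    cycleⱼ-vertex : ∀ b → b < j → Vertex (i + b)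
    path-vertex   : ∀ s → Vertex (i + j + s)

  classify : ∀ a → Vertex a
  classify a with a <? i
  ... | yes a<i = cycleᵢ-vertex a a<i
  ... | no  a≮i with a <? i + j
  ...   | no  a≮i+j = subst Vertex (m+[n∸m]≡n (≮⇒≥ a≮i+j)) (path-vertex (a ∸ (i + j)))
  ...   | yes a<i+j with shift-view (≮⇒≥ a≮i) a<i+j
  ...     | b , b<j , refl = cycleⱼ-vertex b b<j

  bridgeₓ : ∀ a b → Edge a b → (a <ᵇ i) ≡ true → (b <ᵇ i) ≡ false → a ≡ 0 × b ≡ i + j
  bridgeₓ a b (_ , e) a<i b≮i with classify b
  ... | cycleᵢ-vertex b b<i = ⊥-elim (<⇒≱ b<i (<ᵇ-false⇒≥ b≮i))
  ... | cycleⱼ-vertex b b<j = ⊥-elim (false≢true (trans (sym (cycleᵢ-cycleⱼ (<ᵇ-true⇒< a<i) b<j)) e))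
  ... | path-vertex s =
    let (a≡0 , s≡0) = ∧-true (a ≡ᵇ 0) (s ≡ᵇ 0) (trans (sym (cycleᵢ-path (<ᵇ-true⇒< a<i))) e)
    in ≡ᵇ-true⇒≡ a≡0 , trans (cong (i + j +_) (≡ᵇ-true⇒≡ s≡0)) (+-identityʳ (i + j))

  bridgeᵧ : ∀ a b → i ≤ a → i ≤ b → Edge a b → (a <ᵇ i + j) ≡ true → (b <ᵇ i + j) ≡ false →
            a ≡ i × b ≡ i + j + m
  bridgeᵧ a b i≤a i≤b (_ , e) a<i+j b≮i+j with classify a | classify b
  ... | cycleᵢ-vertex a a<i | _ = ⊥-elim (<⇒≱ a<i i≤a)
  ... | path-vertex s | _ = ⊥-elim (<⇒≱ (<ᵇ-true⇒< a<i+j) (m≤m+n (i + j) s))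
  ... | cycleⱼ-vertex _ _ | cycleᵢ-vertex b b<i = ⊥-elim (<⇒≱ b<i i≤b)
  ... | cycleⱼ-vertex _ _ | cycleⱼ-vertex b b<j = ⊥-elim (<⇒≱ (+-monoʳ-< i b<j) (<ᵇ-false⇒≥ b≮i+j))
  ... | cycleⱼ-vertex a a<j | path-vertex s =
    let (a≡0 , s≡m) = ∧-true (a ≡ᵇ 0) (s ≡ᵇ m) (trans (sym (cycleⱼ-path a<j)) e)
    in trans (cong (i +_) (≡ᵇ-true⇒≡ a≡0)) (+-identityʳ i) , cong (i + j +_) (≡ᵇ-true⇒≡ s≡m)

  edges-in-Cᵢ : ∀ a b → 0 ≤ a → a < 0 + i → 0 ≤ b → b < 0 + i → Edge a b → CycleAdj 0 i a b
  edges-in-Cᵢ a b _ a<i _ b<i (_ , e) = cycleRel-true i a b (trans (sym (cycleᵢ a<i b<i)) e)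

  edges-in-Cⱼ : ∀ a b → i ≤ a → a < i + j → i ≤ b → b < i + j → Edge a b → CycleAdj i j a b
  edges-in-Cⱼ a b i≤a a< i≤b b< (_ , e) with shift-view i≤a a< | shift-view i≤b b<
  ... | a' , a'<j , refl | b' , b'<j , refl =
    cycleAdj-shift i j>0 (cycleRel-true j a' b' (trans (sym (cycleⱼ a'<j b'<j)) e))

  edges-on-path : ∀ a b → i + j ≤ a → i + j ≤ b → Edge a b → Neighbours a b
  edges-on-path a b i+j≤a i+j≤b (_ , e) =
    subst₂ Neighbours a≡ b≡ (neighbours-shift (i + j) (pathRel-true _ _ (trans (sym path) e′)))
    where
    a≡ : i + j + (a ∸ (i + j)) ≡ a
    a≡ = m+[n∸m]≡n i+j≤a
    b≡ : i + j + (b ∸ (i + j)) ≡ b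
    b≡ = m+[n∸m]≡n i+j≤b
    e′ : B (i + j + (a ∸ (i + j))) (i + j + (b ∸ (i + j))) ≡ true
    e′ = subst₂ (λ x y → B x y ≡ true) (sym a≡) (sym b≡) e

  IsCycleᵢOrCycleⱼ : ℕ → (ℕ → ℕ) → Set
  IsCycleᵢOrCycleⱼ r c =
    ((Σ ℕ λ t → t < r × c t ≡ 0) × r ≡ i) ⊎ ((Σ ℕ λ t → t < r × c t ≡ i) × r ≡ j)

  module _ (r : ℕ) (r≥3 : 3 ≤ r) (c : ℕ → ℕ)
           (c-inj : ∀ {t t'} → t < r → t' < r → c t ≡ c t' → t ≡ t')
           (c-step : ∀ {t} → suc t < r → Edge (c t) (c (suc t)))
           (c-wrap : Edge (c (r ∸ 1)) (c 0)) where
    open CycleIn Edge Edge-sym r r≥3 c c-inj c-step c-wrap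

    -- First cut at the bridge at x, then at the bridge at y.
    cycle-is-Cᵢ-or-Cⱼ : IsCycleᵢOrCycleⱼ r c
    cycle-is-Cᵢ-or-Cⱼ with one-side (λ _ → ⊤) (λ _ _ → tt) (_<ᵇ i) 0 (i + j) (λ a b _ _ → bridgeₓ a b)
    ... | inj₁ all-in-Cᵢ = inj₁ (fills 0 z≤n i>0 , length≡)
      where open InCycleRegion 0 i edges-in-Cᵢ (λ t t<r → z≤n , <ᵇ-true⇒< (all-in-Cᵢ t t<r))
    ... | inj₂ none-in-Cᵢ
      with one-side (i ≤_) (λ t t<r → <ᵇ-false⇒≥ (none-in-Cᵢ t t<r)) (_<ᵇ i + j) i (i + j + m) bridgeᵧ
    ...   | inj₁ all-in-Cⱼ = inj₂ (fills i ≤-refl (m<m+n i j>0) , length≡)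
      where open InCycleRegion i j edges-in-Cⱼ
                   (λ t t<r → <ᵇ-false⇒≥ (none-in-Cᵢ t t<r) , <ᵇ-true⇒< (all-in-Cⱼ t t<r))
    ...   | inj₂ all-on-path =
      ⊥-elim (not-in-path (i + j ≤_) (λ t t<r → <ᵇ-false⇒≥ (all-on-path t t<r)) edges-on-path)

-- An embedding of D^p_k + D^q_k into B_{i,j,m+1} maps the disjoint
-- cycles C_p and C_q onto disjoint cycles of the butterfly, which must be C_i and
-- C_j in some order; hence {i, j} = {p, q}.
module EmbeddedCycles (p q k i j m : ℕ) (p≥3 : 3 ≤ p) (q≥3 : 3 ≤ q) (i≥3 : 3 ≤ i) (j≥3 : 3 ≤ j)
                      (emb : (D p k ⊕ D q k) ⊑ Butterfly⁺ i j (suc m)) where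
  open CyclesOfButterfly i j m i≥3 j≥3

  nP : ℕ
  nP = size (D p k)

  n : ℕ
  n = size (D p k ⊕ D q k)

  h : Fin n → Fin (size (Butterfly⁺ i j (suc m)))
  h = proj₁ emb

  p≤nP : p ≤ nP
  p≤nP = r≤size-D p k

  n>0 : 0 < n
  n>0 = ≤-trans (3≤⇒0< p≥3) (≤-trans p≤nP (m≤m+n _ _))

  -- The embedding on indices (with an arbitrary value outside the vertex range).
  vertex : ℕ → Fin n
  vertex t with t <? n
  ... | yes t< = fromℕ< t<
  ... | no  _  = fromℕ< n>0

  vertex-index : ∀ {t} → t < n → toℕ (vertex t) ≡ t
  vertex-index {t} t< with t <? n
  ... | yes t<′ = Fin.toℕ-fromℕ< t<′
  ... | no  t≮  = ⊥-elim (t≮ t<)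

  image : ℕ → ℕ
  image t = toℕ (h (vertex t))

  image-edge : ∀ {x y} → x < n → y < n → DDRel p q k x y ≡ true → Edge (image x) (image y)
  image-edge {x} {y} x< y< e = (Fin.toℕ<n (h (vertex x)) , Fin.toℕ<n (h (vertex y))) ,
    trans (sym (represents-butterfly i j (suc m) (h (vertex x)) (h (vertex y))))
      (trans (sym (proj₂ (proj₂ emb) (vertex x) (vertex y)))
        (trans (represents-DD p q k (vertex x) (vertex y))
          (trans (cong₂ (DDRel p q k) (vertex-index x<) (vertex-index y<)) e)))

  image-inj : ∀ {x y} → x < n → y < n → image x ≡ image y → x ≡ y
  image-inj x< y< e =
    trans (sym (vertex-index x<)) (trans (cong toℕ (proj₁ (proj₂ emb) (Fin.toℕ-injective e))) (vertex-index y<))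

  module Image (o r : ℕ) (r≥3 : 3 ≤ r) (placed : ∀ {t} → t < r → o + t < n)
               (cycle-edge : ∀ {a b} → a < r → b < r → cycleRel r a b ≡ true →
                             DDRel p q k (o + a) (o + b) ≡ true) where
    r>0 : 0 < r
    r>0 = 3≤⇒0< r≥3

    c : ℕ → ℕ
    c t = image (o + t)

    c-inj : ∀ {t t'} → t < r → t' < r → c t ≡ c t' → t ≡ t'
    c-inj t< t'< e = +-cancelˡ-≡ o _ _ (image-inj (placed t<) (placed t'<) e)

    c-step : ∀ {t} → suc t < r → Edge (c t) (c (suc t))
    c-step {t} t+1< = image-edge (placed (<-trans (n<1+n t) t+1<)) (placed t+1<)
                        (cycle-edge (<-trans (n<1+n t) t+1<) t+1< (cycleRel-succ r t))

    c-wrap : Edge (c (r ∸ 1)) (c 0)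
    c-wrap = image-edge (placed (pred< r>0)) (placed r>0) (cycle-edge (pred< r>0) r>0 (cycleRel-wrap r r≥3))

    identified : IsCycleᵢOrCycleⱼ r c
    identified = cycle-is-Cᵢ-or-Cⱼ r r≥3 c c-inj c-step c-wrap

  placedP : ∀ {t} → t < p → 0 + t < n
  placedP t< = <-≤-trans t< (≤-trans p≤nP (m≤m+n _ _))

  placedQ : ∀ {t} → t < q → nP + t < n
  placedQ t< = +-monoʳ-< nP (<-≤-trans t< (r≤size-D q k))

  module CycleP = Image 0 p p≥3 placedP
    (λ a< b< e → trans (unionRel-ll {nP} {DRel p k} {DRel q k} (<-≤-trans a< p≤nP) (<-≤-trans b< p≤nP))
                   (trans (DTable.cycle p (3≤⇒0< p≥3) k a< b<) e))
  module CycleQ = Image nP q q≥3 placedQ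
    (λ {a} {b} a< b< e → trans (unionRel-shift {nP} {DRel p k} {DRel q k} a b)
                   (trans (DTable.cycle q (3≤⇒0< q≥3) k a< b<) e))

  disjoint : ∀ {t t' v} → t < p → t' < q → CycleP.c t ≡ v → CycleQ.c t' ≡ v → ⊥
  disjoint {t} {t'} t<p t'<q e e' = separated (<-≤-trans t<p p≤nP) (m≤m+n nP t')
    (image-inj (placedP t<p) (placedQ t'<q) (trans e (sym e')))

  pairs-equal : (i ≡ p × j ≡ q) ⊎ (i ≡ q × j ≡ p)
  pairs-equal with CycleP.identified | CycleQ.identified
  ... | inj₁ (_ , p≡i) | inj₂ (_ , q≡j) = inj₁ (sym p≡i , sym q≡j)
  ... | inj₂ (_ , p≡j) | inj₁ (_ , q≡i) = inj₂ (sym q≡i , sym p≡j)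
  ... | inj₁ ((t , t< , e) , _) | inj₁ ((t' , t'< , e') , _) = ⊥-elim (disjoint t< t'< e e')
  ... | inj₂ ((t , t< , e) , _) | inj₂ ((t' , t'< , e') , _) = ⊥-elim (disjoint t< t'< e e')

-- Counting.  Sums over Fin n come from the library; sums over an initial segment
-- of ℕ are needed separately, since the compression below sums over a growing range.

indicator : Bool → ℕ
indicator true  = 1
indicator false = 0

indicator-∨ : ∀ a b → indicator (a ∨ b) ≤ indicator a + indicator b
indicator-∨ true  b = s≤s z≤n
indicator-∨ false b = ≤-refl

sumTo : ℕ → (ℕ → ℕ) → ℕ
sumTo zero    g = 0
sumTo (suc K) g = sumTo K g + g K

sumTo-mono : ∀ K {a b : ℕ → ℕ} → (∀ e → e < K → a e ≤ b e) → sumTo K a ≤ sumTo K b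
sumTo-mono zero    a≤b = z≤n
sumTo-mono (suc K) a≤b = +-mono-≤ (sumTo-mono K (λ e e< → a≤b e (m≤n⇒m≤1+n e<))) (a≤b K ≤-refl)

sumTo-extend : ∀ {K K'} (g : ℕ → ℕ) → K ≤ K' → sumTo K g ≤ sumTo K' g
sumTo-extend {K' = zero}   g z≤n = ≤-refl
sumTo-extend {K} {suc K'} g K≤1+K' with m≤n⇒m<n∨m≡n K≤1+K'
... | inj₁ K<1+K' = ≤-trans (sumTo-extend g (s≤s⁻¹ K<1+K')) (m≤m+n _ _)
... | inj₂ refl   = ≤-refl

sumTo-head : ∀ K (g : ℕ → ℕ) → sumTo (suc K) g ≡ g 0 + sumTo K (g ∘ suc)
sumTo-head zero    g = +-comm 0 (g 0)
sumTo-head (suc K) g rewrite sumTo-head K g = +-assoc (g 0) _ _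

sumTo-+ : ∀ K (a b : ℕ → ℕ) → sumTo K (λ e → a e + b e) ≡ sumTo K a + sumTo K b
sumTo-+ zero    a b = refl
sumTo-+ (suc K) a b rewrite sumTo-+ K a b = interchange (sumTo K a) (sumTo K b) (a K) (b K)

sum-term : ∀ {n} (g : Fin n → ℕ) v → g v ≤ sum g
sum-term g Fin.zero    = m≤m+n (g Fin.zero) _
sum-term g (Fin.suc v) = ≤-trans (sum-term (g ∘ Fin.suc) v) (m≤n+m _ (g Fin.zero))

sum-≤1 : ∀ {n} (g : Fin n → ℕ) → (∀ v → g v ≤ 1) → sum g ≤ n
sum-≤1 {zero}  g g≤1 = z≤n
sum-≤1 {suc n} g g≤1 = +-mono-≤ (g≤1 Fin.zero) (sum-≤1 (g ∘ Fin.suc) (g≤1 ∘ Fin.suc))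

sumTo-sum-comm : ∀ K {n} (g : ℕ → Fin n → ℕ) →
                 sumTo K (λ e → sum (g e)) ≡ sum (λ v → sumTo K (λ e → g e v))
sumTo-sum-comm zero    {n} g = sym (sum-replicate-zero n)
sumTo-sum-comm (suc K) {n} g rewrite sumTo-sum-comm K g =
  sym (∑-distrib-+ (λ v → sumTo K (λ e → g e v)) (g K))

occurrences : ℕ → ℕ → (ℕ → ℕ) → ℕ
occurrences K x g = sumTo K (λ e → indicator (x ≡ᵇ g e))

occurrences-none : ∀ K {x} g → (∀ e → e < K → x ≢ g e) → occurrences K x g ≡ 0
occurrences-none zero    g x∉ = refl
occurrences-none (suc K) g x∉
  rewrite occurrences-none K g (λ e e< → x∉ e (m≤n⇒m≤1+n e<)) | ≢⇒≡ᵇ-false (x∉ K ≤-refl) = refl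

occurrences-≤1 : ∀ K x g → (∀ {e e'} → e < K → e' < K → g e ≡ g e' → e ≡ e') → occurrences K x g ≤ 1
occurrences-≤1 zero    x g g-inj = z≤n
occurrences-≤1 (suc K) x g g-inj with x ≟ g K
... | yes refl
  rewrite occurrences-none K {g K} g (λ e e< e≡ → <-irrefl (g-inj (m≤n⇒m≤1+n e<) ≤-refl (sym e≡)) e<)
        | ≡⇒≡ᵇ-true {g K} refl = ≤-refl
... | no x≢gK rewrite ≢⇒≡ᵇ-false x≢gK | +-identityʳ (occurrences K x g) =
  occurrences-≤1 K x g (λ e< e'< → g-inj (m≤n⇒m≤1+n e<) (m≤n⇒m≤1+n e'<))

occurrences₂-≤1 : ∀ K x g g' → (∀ {e e'} → e < K → e' < K → g e ≡ g e' → e ≡ e') →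
                  (∀ {e e'} → e < K → e' < K → g' e ≡ g' e' → e ≡ e') →
                  (∀ {e e'} → e < K → e' < K → g e ≢ g' e') → occurrences K x g + occurrences K x g' ≤ 1
occurrences₂-≤1 K x g g' g-inj g'-inj disjoint with search (λ e → x ≡ᵇ g e) false K
... | inj₁ x∉g rewrite occurrences-none K {x} g (λ e e< → ≡ᵇ-false⇒≢ (x∉g e e<)) =
  occurrences-≤1 K x g' g'-inj
... | inj₂ (e , e< , x≡ge)
  rewrite occurrences-none K {x} g' (λ e' e'< x≡g'e' → disjoint e< e'< (trans (sym (≡ᵇ-true⇒≡ x≡ge)) x≡g'e'))
        | +-identityʳ (occurrences K x g) = occurrences-≤1 K x g g-inj

-- Consecutive used
-- positions stay consecutive, while every gap of unused positions shrinks to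
-- length at most one; so the used positions up to d fit into 2·(number used).
module Compression (U : ℕ → Bool) where
  pos : ℕ → ℕ
  pos d = sumTo d (λ e → indicator (U e ∨ U (suc e)))

  used-count : ℕ → ℕ
  used-count K = sumTo K (indicator ∘ U)

  pos-step : ∀ {d} → U (suc d) ≡ true → pos (suc d) ≡ suc (pos d)
  pos-step {d} Ud+1 rewrite Ud+1 | ∨-zeroʳ (U d) = +-comm (pos d) 1

  pos-mono : ∀ {d d'} → d ≤ d' → pos d ≤ pos d'
  pos-mono = sumTo-extend _

  pos-jump : ∀ {d d'} → U (suc d) ≡ true → suc (suc d) ≤ d' → suc (suc (pos d)) ≤ pos d'
  pos-jump {d} {d'} Ud+1 d+2≤d' = subst (_≤ pos d') pos-d+2 (pos-mono d+2≤d')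
    where
    pos-d+2 : pos (suc (suc d)) ≡ suc (suc (pos d))
    pos-d+2 = begin
      pos (suc d) + indicator (U (suc d) ∨ U (suc (suc d)))
        ≡⟨ cong (λ b → pos (suc d) + indicator (b ∨ U (suc (suc d)))) Ud+1 ⟩
      pos (suc d) + 1                                        ≡⟨ +-comm (pos (suc d)) 1 ⟩
      suc (pos (suc d))                                      ≡⟨ cong suc (pos-step Ud+1) ⟩
      suc (suc (pos d))                                      ∎
      where open ≡-Reasoning

  pos-positive : ∀ {d} → U 0 ≡ true → 1 ≤ pos (suc d)
  pos-positive {d} U0 = ≤-trans (≤-reflexive (sym pos-1)) (pos-mono {1} {suc d} (s≤s z≤n))
    where
    pos-1 : pos 1 ≡ 1
    pos-1 rewrite U0 = refl

  pos-bound : ∀ {d} → U (suc d) ≡ true → pos d + 2 ≤ 2 * used-count (suc (suc d))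
  pos-bound {d} Ud+1 = begin
      pos d + 2           ≤⟨ +-monoˡ-≤ 2 pos≤A+A′ ⟩
      (A + A′) + 2        ≡⟨ rearrange A A′ ⟩
      (A + 1) + (1 + A′)  ≤⟨ +-mono-≤ A+1≤ 1+A′≤ ⟩
      S + S               ≡⟨ cong (S +_) (sym (+-identityʳ S)) ⟩
      2 * S               ∎
    where
    open ≤-Reasoning
    S : ℕ
    S = used-count (suc (suc d))
    A : ℕ
    A = used-count d
    A′ : ℕ
    A′ = sumTo d (indicator ∘ U ∘ suc)
    pos≤A+A′ : pos d ≤ A + A′
    pos≤A+A′ = ≤-trans (sumTo-mono d (λ e _ → indicator-∨ (U e) (U (suc e))))
                       (≤-reflexive (sumTo-+ d (indicator ∘ U) (indicator ∘ U ∘ suc)))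
    rearrange : ∀ a b → (a + b) + 2 ≡ (a + 1) + (1 + b)
    rearrange a b = trans (+-assoc a b 2) (trans (cong (a +_) (+-comm b 2)) (sym (+-assoc a 1 (1 + b))))
    A+1≤ : A + 1 ≤ S
    A+1≤ rewrite Ud+1 = +-monoˡ-≤ 1 (m≤m+n A (indicator (U d)))
    1+A′≤ : 1 + A′ ≤ S
    1+A′≤ rewrite sumTo-head (suc d) (indicator ∘ U) | Ud+1 =
      ≤-trans (≤-reflexive (+-comm 1 A′)) (m≤n+m (A′ + 1) (indicator (U 0)))

Apart : ℕ → ℕ → Set
Apart a b = suc (suc a) ≤ b ⊎ suc (suc b) ≤ a

apart-pathRel : ∀ {a b} → Apart a b → pathRel a b ≡ false
apart-pathRel {a} {b} (inj₁ a+2≤b) = pathRel-far a+2≤b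
apart-pathRel {a} {b} (inj₂ b+2≤a) = trans (pathRel-sym a b) (pathRel-far b+2≤a)

apart-≢ : ∀ {a b} → Apart a b → a ≢ b
apart-≢ (inj₁ a+2≤b) refl = 1+n≰n (≤-trans (n≤1+n _) a+2≤b)
apart-≢ (inj₂ b+2≤a) refl = 1+n≰n (≤-trans (n≤1+n _) b+2≤a)

module PathMap (V : ℕ → Set) (g : ℕ → ℕ)
               (keeps-adjacent : ∀ {d} → V d → V (suc d) → pathRel (g d) (g (suc d)) ≡ true)
               (keeps-apart : ∀ {d d'} → V d → V d' → suc (suc d) ≤ d' → Apart (g d) (g d')) where
  private
    ordered : ∀ {d d'} → V d → V d' → d < d' → pathRel d d' ≡ pathRel (g d) (g d') × g d ≢ g d'
    ordered {d} vd vd' d<d' with m≤n⇒m<n∨m≡n d<d'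
    ... | inj₂ refl = trans (pathRel-succ d) (sym (keeps-adjacent vd vd')) ,
                      λ e → false≢true (trans (sym (pathRel-refl (g d)))
                                              (trans (cong (pathRel (g d)) e) (keeps-adjacent vd vd')))
    ... | inj₁ d+2≤d' = trans (pathRel-far d+2≤d') (sym (apart-pathRel (keeps-apart vd vd' d+2≤d'))) ,
                        apart-≢ (keeps-apart vd vd' d+2≤d')

  preserves : ∀ {d d'} → V d → V d' → pathRel d d' ≡ pathRel (g d) (g d')
  preserves {d} {d'} vd vd' with <-cmp d d'
  ... | tri< d<d' _ _ = proj₁ (ordered vd vd' d<d')
  ... | tri≈ _ refl _ = trans (pathRel-refl d) (sym (pathRel-refl (g d)))
  ... | tri> _ _ d'<d = trans (pathRel-sym d d') (trans (proj₁ (ordered vd' vd d'<d)) (pathRel-sym (g d') (g d)))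

  injective : ∀ {d d'} → V d → V d' → g d ≡ g d' → d ≡ d'
  injective {d} {d'} vd vd' e with <-cmp d d'
  ... | tri< d<d' _ _ = ⊥-elim (proj₂ (ordered vd vd' d<d') e)
  ... | tri≈ _ d≡d' _ = d≡d'
  ... | tri> _ _ d'<d = ⊥-elim (proj₂ (ordered vd' vd d'<d) (sym e))

reflect-step : ∀ {m a} → suc a ≤ m → m ∸ a ≡ suc (m ∸ suc a)
reflect-step {suc m} {zero}  (s≤s z≤n) = refl
reflect-step {suc m} {suc a} (s≤s a<m) = reflect-step a<m

reflect-apart : ∀ {m a b} → suc (suc a) ≤ b → b ≤ m → suc (suc (m ∸ b)) ≤ m ∸ a
reflect-apart {m} {a} {b} a+2≤b b≤m =
  subst (suc (suc (m ∸ b)) ≤_) (sym m-a≡) (s≤s (s≤s (∸-monoʳ-≤ m a+2≤b)))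
  where
  m-a≡ : m ∸ a ≡ suc (suc (m ∸ suc (suc a)))
  m-a≡ = trans (reflect-step (≤-trans (≤-trans (n≤1+n (suc a)) a+2≤b) b≤m))
               (cong suc (reflect-step (≤-trans a+2≤b b≤m)))

-- Let H be embedded in D^p_k + D^q_k by f, with |H| = n > 0, and let the
-- butterfly B_{p,q,m+1} have m + 1 = 2n path edges.  We embed H into it: the cycles
-- go to C_p and C_q, the used part of the tail of D^p_k is compressed onto the
-- path from its x-end, and the used part of the tail of D^q_k from its y-end.
-- Each compressed tail occupies at most twice as many path vertices as H has
-- vertices on it, so the two never come close to each other.
module TailCompression (H : Graph) (p q k m : ℕ) (p≥3 : 3 ≤ p) (q≥3 : 3 ≤ q)
                       (room : suc m ≡ 2 * size H) (emb : H ⊑ (D p k ⊕ D q k)) where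
  n : ℕ
  n = size H

  nP : ℕ
  nP = size (D p k)

  N : ℕ
  N = size (D p k ⊕ D q k)

  p>0 : 0 < p
  p>0 = 3≤⇒0< p≥3

  q>0 : 0 < q
  q>0 = 3≤⇒0< q≥3

  f : Fin n → Fin N
  f = proj₁ emb

  F : Fin n → ℕ
  F v = toℕ (f v)

  -- The vertices of each component along which the tail hangs: position 0 is the
  -- cycle vertex joined to the tail, position d+1 the d-th tail vertex.
  codeP : ℕ → ℕ
  codeP zero    = 0
  codeP (suc d) = p + d

  codeQ : ℕ → ℕ
  codeQ zero    = nP
  codeQ (suc d) = nP + (q + d)

  hits : (ℕ → ℕ) → ℕ → ℕ
  hits code e = sum (λ v → indicator (F v ≡ᵇ code e))

  Occupied : (ℕ → ℕ) → ℕ → Bool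
  Occupied code e = 0 <ᵇ hits code e

  occupied : ∀ code e v → F v ≡ code e → Occupied code e ≡ true
  occupied code e v Fv≡ with hits code e | sum-term (λ v → indicator (F v ≡ᵇ code e)) v
  ... | zero  | hit≤0 rewrite ≡⇒≡ᵇ-true Fv≡ with () ← hit≤0
  ... | suc _ | _     = refl

  indicator-occupied≤ : ∀ code e → indicator (Occupied code e) ≤ hits code e
  indicator-occupied≤ code e with hits code e
  ... | zero  = z≤n
  ... | suc _ = s≤s z≤n

  module CP = Compression (Occupied codeP)
  module CQ = Compression (Occupied codeQ)

  K : ℕ
  K = suc k

  codeP-inj : ∀ {e e'} → e < K → e' < K → codeP e ≡ codeP e' → e ≡ e'
  codeP-inj {zero}  {zero}   _ _ _ = refl
  codeP-inj {zero}  {suc d}  _ _ e = ⊥-elim (separated p>0 (m≤m+n p d) e)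
  codeP-inj {suc d} {zero}   _ _ e = ⊥-elim (separated p>0 (m≤m+n p d) (sym e))
  codeP-inj {suc d} {suc d'} _ _ e = cong suc (+-cancelˡ-≡ p _ _ e)

  codeQ-inj : ∀ {e e'} → e < K → e' < K → codeQ e ≡ codeQ e' → e ≡ e'
  codeQ-inj {zero}  {zero}   _ _ _ = refl
  codeQ-inj {zero}  {suc d}  _ _ e =
    ⊥-elim (separated q>0 (m≤m+n q d) (+-cancelˡ-≡ nP _ _ (trans (+-identityʳ nP) e)))
  codeQ-inj {suc d} {zero}   _ _ e =
    ⊥-elim (separated q>0 (m≤m+n q d) (+-cancelˡ-≡ nP _ _ (trans (+-identityʳ nP) (sym e))))
  codeQ-inj {suc d} {suc d'} _ _ e = cong suc (+-cancelˡ-≡ q _ _ (+-cancelˡ-≡ nP _ _ e))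

  codeP<nP : ∀ {e} → e < K → codeP e < nP
  codeP<nP {zero}  _         = ≤-trans p>0 (r≤size-D p k)
  codeP<nP {suc d} (s≤s d<k) = subst (p + d <_) (sym (size-D p k)) (+-monoʳ-< p d<k)

  nP≤codeQ : ∀ e → nP ≤ codeQ e
  nP≤codeQ zero    = ≤-refl
  nP≤codeQ (suc d) = m≤m+n nP _

  -- Double counting: the used positions of both components together are at most n.
  used≤ : ∀ code → Compression.used-count (Occupied code) K ≤ sum (λ v → occurrences K (F v) code)
  used≤ code = ≤-trans (sumTo-mono K (λ e _ → indicator-occupied≤ code e))
                         (≤-reflexive (sumTo-sum-comm K (λ e v → indicator (F v ≡ᵇ code e))))

  used-total : CP.used-count K + CQ.used-count K ≤ n
  used-total = begin
    CP.used-count K + CQ.used-count K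
      ≤⟨ +-mono-≤ (used≤ codeP) (used≤ codeQ) ⟩
    sum (λ v → occurrences K (F v) codeP) + sum (λ v → occurrences K (F v) codeQ)
      ≡⟨ sym (∑-distrib-+ (λ v → occurrences K (F v) codeP) (λ v → occurrences K (F v) codeQ)) ⟩
    sum (λ v → occurrences K (F v) codeP + occurrences K (F v) codeQ)
      ≤⟨ sum-≤1 _ (λ v → occurrences₂-≤1 K (F v) codeP codeQ codeP-inj codeQ-inj
                           (λ {e} {e'} e< _ → separated (codeP<nP e<) (nP≤codeQ e'))) ⟩
    n ∎
    where open ≤-Reasoning

  UsedAt : ℕ → Set
  UsedAt x = Σ (Fin n) λ v → F v ≡ x

  UsedTailP : ℕ → Set
  UsedTailP d = UsedAt (p + d) × d < k

  UsedTailQ : ℕ → Set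
  UsedTailQ d = UsedAt (nP + (q + d)) × d < k

  occupiedP : ∀ {d} → UsedTailP d → Occupied codeP (suc d) ≡ true
  occupiedP {d} ((v , Fv≡) , _) = occupied codeP (suc d) v Fv≡

  occupiedQ : ∀ {d} → UsedTailQ d → Occupied codeQ (suc d) ≡ true
  occupiedQ {d} ((v , Fv≡) , _) = occupied codeQ (suc d) v Fv≡

  boundP : ∀ {d} → UsedTailP d → CP.pos d + 2 ≤ 2 * CP.used-count K
  boundP {d} ud = ≤-trans (CP.pos-bound (occupiedP ud))
                          (*-monoʳ-≤ 2 (sumTo-extend (indicator ∘ Occupied codeP) (s≤s (proj₂ ud))))

  boundQ : ∀ {d} → UsedTailQ d → CQ.pos d + 2 ≤ 2 * CQ.used-count K
  boundQ {d} ud = ≤-trans (CQ.pos-bound (occupiedQ ud))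
                          (*-monoʳ-≤ 2 (sumTo-extend (indicator ∘ Occupied codeQ) (s≤s (proj₂ ud))))

  room-total : 2 * CP.used-count K + 2 * CQ.used-count K ≤ suc m
  room-total = begin
    2 * CP.used-count K + 2 * CQ.used-count K ≡⟨ sym (*-distribˡ-+ 2 (CP.used-count K) (CQ.used-count K)) ⟩
    2 * (CP.used-count K + CQ.used-count K)   ≤⟨ *-monoʳ-≤ 2 used-total ⟩
    2 * n                                     ≡⟨ sym room ⟩
    suc m                                     ∎
    where open ≤-Reasoning

  posP<m : ∀ {d} → UsedTailP d → CP.pos d < m
  posP<m {d} ud = s≤s⁻¹ (≤-trans (≤-reflexive (+-comm 2 (CP.pos d)))
                    (≤-trans (boundP ud) (≤-trans (m≤m+n _ (2 * CQ.used-count K)) room-total)))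

  posQ<m : ∀ {d} → UsedTailQ d → CQ.pos d < m
  posQ<m {d} ud = s≤s⁻¹ (≤-trans (≤-reflexive (+-comm 2 (CQ.pos d)))
                    (≤-trans (boundQ ud) (≤-trans (m≤n+m _ (2 * CP.used-count K)) room-total)))

  tails-apart : ∀ {d d'} → UsedTailP d → UsedTailQ d' → suc (suc (CP.pos d)) ≤ m ∸ CQ.pos d'
  tails-apart {d} {d'} ud ud' = subst (_≤ m ∸ CQ.pos d') (+-comm (CP.pos d) 2) (m+n≤o⇒m≤o∸n _ fits)
    where
    both : (CP.pos d + 2) + (CQ.pos d' + 2) ≤ suc m
    both = ≤-trans (+-mono-≤ (boundP ud) (boundQ ud')) room-total
    X : ℕ
    X = CP.pos d + 2
    Y : ℕ
    Y = CQ.pos d'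
    fits : X + Y ≤ m
    fits = ≤-trans (n≤1+n _) (s≤s⁻¹ (subst (_≤ suc m) X+[Y+2]≡ both))
      where
      X+[Y+2]≡ : X + (Y + 2) ≡ suc (suc (X + Y))
      X+[Y+2]≡ = trans (cong (X +_) (+-comm Y 2)) (trans (+-suc X (suc Y)) (cong suc (+-suc X Y)))

  fromY : ℕ → ℕ
  fromY d = m ∸ CQ.pos d

  fromY-step : ∀ {d} → UsedTailQ d → fromY d ≡ suc (fromY (suc d))
  fromY-step {d} ud =
    trans (reflect-step (posQ<m ud)) (cong (λ z → suc (m ∸ z)) (sym (CQ.pos-step (occupiedQ ud))))

  module EmbedTailP = PathMap UsedTailP CP.pos
    (λ {d} ud _ → subst (λ z → pathRel (CP.pos d) z ≡ true) (sym (CP.pos-step (occupiedP ud)))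
                    (pathRel-succ (CP.pos d)))
    (λ ud _ d+2≤d' → inj₁ (CP.pos-jump (occupiedP ud) d+2≤d'))

  module EmbedTailQ = PathMap UsedTailQ fromY
    (λ {d} ud _ → subst (λ z → pathRel z (fromY (suc d)) ≡ true) (sym (fromY-step ud))
                    (trans (pathRel-sym (suc (fromY (suc d))) (fromY (suc d))) (pathRel-succ (fromY (suc d)))))
    (λ ud ud' d+2≤d' → inj₂ (reflect-apart (CQ.pos-jump (occupiedQ ud) d+2≤d') (<⇒≤ (posQ<m ud'))))

  data Kind : ℕ → Set where
    cycleP : ∀ a → a < p → Kind a
    tailP  : ∀ d → d < k → Kind (p + d)
    cycleQ : ∀ b → b < q → Kind (nP + b)
    tailQ  : ∀ d → d < k → Kind (nP + (q + d))

  N≡ : N ≡ nP + q + k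
  N≡ = trans (cong (nP +_) (size-D q k)) (sym (+-assoc nP q k))

  kind : ∀ x → x < N → Kind x
  kind x x<N with x <? p | x <? nP | x <? nP + q
  ... | yes x<p | _ | _ = cycleP x x<p
  ... | no x≮p | yes x<nP | _ with shift-view (≮⇒≥ x≮p) (subst (x <_) (size-D p k) x<nP)
  ...   | d , d<k , refl = tailP d d<k
  kind x x<N | no _ | no x≮nP | yes x<nP+q with shift-view (≮⇒≥ x≮nP) x<nP+q
  ...   | b , b<q , refl = cycleQ b b<q
  kind x x<N | no _ | no _ | no x≮nP+q with shift-view (≮⇒≥ x≮nP+q) (subst (x <_) N≡ x<N)
  ...   | d , d<k , refl = subst Kind (sym (+-assoc nP q d)) (tailQ d d<k)

  target : ∀ {x} → Kind x → ℕ
  target (cycleP a _) = a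
  target (tailP d _)  = p + q + CP.pos d
  target (cycleQ b _) = p + b
  target (tailQ d _)  = p + q + fromY d

  Bsize : ℕ
  Bsize = size (Butterfly⁺ p q (suc m))

  target< : ∀ {x} (κ : Kind x) → UsedAt x → target κ < Bsize
  target< (cycleP a a<p) _ = <-≤-trans a<p (i≤i+j+m p q (suc m))
  target< (tailP d d<k)  u = +-monoʳ-< (p + q) (<-trans (posP<m (u , d<k)) (n<1+n m))
  target< (cycleQ b b<q) _ = <-≤-trans (+-monoʳ-< p b<q) (m≤m+n (p + q) _)
  target< (tailQ d _)    _ = +-monoʳ-< (p + q) (s≤s (m∸n≤m m (CQ.pos d)))

  open ButterflyTable p q m p>0 q>0
  module DTableP = DTable p p>0
  module DTableQ = DTable q q>0

  DD : IndexRel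
  DD = DDRel p q k

  B-sym : ∀ {a b} → a < Bsize → b < Bsize → B a b ≡ B b a
  B-sym = represents-sym {Butterfly⁺ p q (suc m)} (represents-butterfly p q (suc m))

  DD-sym : ∀ {a b} → a < N → b < N → DD a b ≡ DD b a
  DD-sym = represents-sym {D p k ⊕ D q k} (represents-DD p q k)

  a<nP : ∀ {a} → a < p → a < nP
  a<nP a<p = <-≤-trans a<p (r≤size-D p k)

  p+d<nP : ∀ {d} → d < k → p + d < nP
  p+d<nP d<k = subst (_ <_) (sym (size-D p k)) (+-monoʳ-< p d<k)

  DD-P : ∀ {x y} → x < nP → y < nP → DD x y ≡ DRel p k x y
  DD-P = unionRel-ll {nP} {DRel p k} {DRel q k}

  DD-PQ : ∀ {x y} → x < nP → DD x (nP + y) ≡ false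
  DD-PQ {y = y} x<nP = unionRel-lr {nP} {DRel p k} {DRel q k} x<nP (m≤m+n nP y)

  DD-Q : ∀ {x y} → DD (nP + x) (nP + y) ≡ DRel q k x y
  DD-Q {x} {y} = unionRel-shift {nP} {DRel p k} {DRel q k} x y

  -- The joint between cycle vertex 0 and the first tail vertex is seen correctly:
  -- if cycle vertex 0 is used, only the first tail vertex is compressed to 0 …
  joint-P : ∀ a d → UsedAt a → ((a ≡ᵇ 0) ∧ (d ≡ᵇ 0)) ≡ ((a ≡ᵇ 0) ∧ (CP.pos d ≡ᵇ 0))
  joint-P a d _ with a ≟ 0
  ... | no a≢0 rewrite ≢⇒≡ᵇ-false a≢0 = refl
  joint-P .0 zero    _        | yes refl = refl
  joint-P .0 (suc d) (v , Fv≡0) | yes refl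
    rewrite ≢⇒≡ᵇ-false {CP.pos (suc d)} {0}
              (λ e → <-irrefl (sym e) (CP.pos-positive {d} (occupied codeP 0 v Fv≡0))) = refl

  -- … and symmetrically at the y-end.
  joint-Q : ∀ b d → UsedAt (nP + b) → UsedTailQ d →
            ((b ≡ᵇ 0) ∧ (d ≡ᵇ 0)) ≡ ((b ≡ᵇ 0) ∧ (fromY d ≡ᵇ m))
  joint-Q b d _ _ with b ≟ 0
  ... | no b≢0 rewrite ≢⇒≡ᵇ-false b≢0 = refl
  joint-Q .0 zero    _            _  | yes refl rewrite ≡⇒≡ᵇ-true {m} refl = refl
  joint-Q .0 (suc d) (v , Fv≡nP+0) ud | yes refl
    rewrite ≢⇒≡ᵇ-false {fromY (suc d)} {m}
              (λ e → <-irrefl (sym (∸-cancelˡ-≡ (<⇒≤ (posQ<m ud)) z≤n e))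
                              (CQ.pos-positive {d} (occupied codeQ 0 v (trans Fv≡nP+0 (+-identityʳ nP))))) = refl

  fromY≢0 : ∀ {d} → UsedTailQ d → fromY d ≢ 0
  fromY≢0 ud e = <-irrefl refl (<-≤-trans (posQ<m ud) (m∸n≡0⇒m≤n e))

  cycleP-cycleP : ∀ {a a'} → a < p → a' < p → DD a a' ≡ B a a'
  cycleP-cycleP a<p a'<p = trans (DD-P (a<nP a<p) (a<nP a'<p))
                             (trans (DTableP.cycle k a<p a'<p) (sym (cycleᵢ a<p a'<p)))

  cycleP-tailP : ∀ {a d} → a < p → d < k → UsedAt a → DD a (p + d) ≡ B a (p + q + CP.pos d)
  cycleP-tailP {a} {d} a<p d<k ua = trans (DD-P (a<nP a<p) (p+d<nP d<k))
    (trans (DTableP.cycle-tail k a<p d<k) (trans (joint-P a d ua) (sym (cycleᵢ-path a<p))))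

  cycleP-cycleQ : ∀ {a b} → a < p → b < q → DD a (nP + b) ≡ B a (p + b)
  cycleP-cycleQ a<p b<q = trans (DD-PQ (a<nP a<p)) (sym (cycleᵢ-cycleⱼ a<p b<q))

  cycleP-tailQ : ∀ {a d} → a < p → UsedTailQ d → DD a (nP + (q + d)) ≡ B a (p + q + fromY d)
  cycleP-tailQ {a} a<p ud = trans (DD-PQ (a<nP a<p))
    (sym (trans (cycleᵢ-path a<p) (trans (cong ((a ≡ᵇ 0) ∧_) (≢⇒≡ᵇ-false (fromY≢0 ud))) (∧-zeroʳ _))))

  tailP-tailP : ∀ {d d'} → UsedTailP d → UsedTailP d' →
                DD (p + d) (p + d') ≡ B (p + q + CP.pos d) (p + q + CP.pos d')
  tailP-tailP ud ud' = trans (DD-P (p+d<nP (proj₂ ud)) (p+d<nP (proj₂ ud')))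
    (trans (DTableP.tail k (proj₂ ud) (proj₂ ud')) (trans (EmbedTailP.preserves ud ud') (sym path)))

  tailP-cycleQ : ∀ {d b} → UsedTailP d → b < q → UsedAt (nP + b) →
                 DD (p + d) (nP + b) ≡ B (p + q + CP.pos d) (p + b)
  tailP-cycleQ {d} {b} ud b<q ub = trans (DD-PQ (p+d<nP (proj₂ ud)))
    (sym (trans (B-sym (target< (tailP d (proj₂ ud)) (proj₁ ud)) (target< (cycleQ b b<q) ub))
         (trans (cycleⱼ-path b<q)
           (trans (cong ((b ≡ᵇ 0) ∧_) (≢⇒≡ᵇ-false (<⇒≢ (posP<m ud)))) (∧-zeroʳ _)))))

  tailP-tailQ : ∀ {d d'} → UsedTailP d → UsedTailQ d' →
                DD (p + d) (nP + (q + d')) ≡ B (p + q + CP.pos d) (p + q + fromY d')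
  tailP-tailQ ud ud' = trans (DD-PQ (p+d<nP (proj₂ ud))) (sym (trans path (pathRel-far (tails-apart ud ud'))))

  cycleQ-cycleQ : ∀ {b b'} → b < q → b' < q → DD (nP + b) (nP + b') ≡ B (p + b) (p + b')
  cycleQ-cycleQ b<q b'<q = trans DD-Q (trans (DTableQ.cycle k b<q b'<q) (sym (cycleⱼ b<q b'<q)))

  cycleQ-tailQ : ∀ {b d} → b < q → UsedAt (nP + b) → UsedTailQ d →
                 DD (nP + b) (nP + (q + d)) ≡ B (p + b) (p + q + fromY d)
  cycleQ-tailQ {b} {d} b<q ub ud = trans DD-Q
    (trans (DTableQ.cycle-tail k b<q (proj₂ ud)) (trans (joint-Q b d ub ud) (sym (cycleⱼ-path b<q))))

  tailQ-tailQ : ∀ {d d'} → UsedTailQ d → UsedTailQ d' →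
                DD (nP + (q + d)) (nP + (q + d')) ≡ B (p + q + fromY d) (p + q + fromY d')
  tailQ-tailQ ud ud' =
    trans DD-Q (trans (DTableQ.tail k (proj₂ ud) (proj₂ ud')) (trans (EmbedTailQ.preserves ud ud') (sym path)))

  -- Both relations are symmetric, so each pair of kinds needs checking in one order only.
  reversed : ∀ {x y} (κ : Kind x) (κ′ : Kind y) → UsedAt x → UsedAt y →
             DD y x ≡ B (target κ′) (target κ) → DD x y ≡ B (target κ) (target κ′)
  reversed κ κ′ ux uy e =
    trans (DD-sym (used<N ux) (used<N uy)) (trans e (B-sym (target< κ′ uy) (target< κ ux)))
    where used<N : ∀ {x} → UsedAt x → x < N
          used<N (v , refl) = Fin.toℕ<n (f v)

  adjacency : ∀ {x y} (κ : Kind x) (κ′ : Kind y) → UsedAt x → UsedAt y →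
              DD x y ≡ B (target κ) (target κ′)
  adjacency (cycleP a a<p) (cycleP a' a'<p) ux uy = cycleP-cycleP a<p a'<p
  adjacency (cycleP a a<p) (tailP d d<k)    ux uy = cycleP-tailP a<p d<k ux
  adjacency (cycleP a a<p) (cycleQ b b<q)   ux uy = cycleP-cycleQ a<p b<q
  adjacency (cycleP a a<p) (tailQ d d<k)    ux uy = cycleP-tailQ a<p (uy , d<k)
  adjacency (tailP d d<k)  (tailP d' d'<k)  ux uy = tailP-tailP (ux , d<k) (uy , d'<k)
  adjacency (tailP d d<k)  (cycleQ b b<q)   ux uy = tailP-cycleQ (ux , d<k) b<q uy
  adjacency (tailP d d<k)  (tailQ d' d'<k)  ux uy = tailP-tailQ (ux , d<k) (uy , d'<k)
  adjacency (cycleQ b b<q) (cycleQ b' b'<q) ux uy = cycleQ-cycleQ b<q b'<q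
  adjacency (cycleQ b b<q) (tailQ d d<k)    ux uy = cycleQ-tailQ b<q ux (uy , d<k)
  adjacency (tailQ d d<k)  (tailQ d' d'<k)  ux uy = tailQ-tailQ (ux , d<k) (uy , d'<k)
  adjacency κ@(tailP d d<k)  κ′@(cycleP a a<p)  ux uy = reversed κ κ′ ux uy (cycleP-tailP a<p d<k uy)
  adjacency κ@(cycleQ b b<q) κ′@(cycleP a a<p)  ux uy = reversed κ κ′ ux uy (cycleP-cycleQ a<p b<q)
  adjacency κ@(cycleQ b b<q) κ′@(tailP d d<k)   ux uy = reversed κ κ′ ux uy (tailP-cycleQ (uy , d<k) b<q ux)
  adjacency κ@(tailQ d d<k)  κ′@(cycleP a a<p)  ux uy = reversed κ κ′ ux uy (cycleP-tailQ a<p (ux , d<k))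
  adjacency κ@(tailQ d d<k)  κ′@(tailP d' d'<k) ux uy = reversed κ κ′ ux uy (tailP-tailQ (uy , d'<k) (ux , d<k))
  adjacency κ@(tailQ d d<k)  κ′@(cycleQ b b<q)  ux uy = reversed κ κ′ ux uy (cycleQ-tailQ b<q uy (ux , d<k))

  -- Different kinds go to disjoint ranges of the butterfly, and each kind is placed injectively.
  injectivity : ∀ {x y} (κ : Kind x) (κ′ : Kind y) → UsedAt x → UsedAt y →
                target κ ≡ target κ′ → x ≡ y
  injectivity (cycleP a _)   (cycleP a' _)    _  _  e = e
  injectivity (cycleP a a<p) (tailP d _)      _  _  e = ⊥-elim (separated a<p (i≤i+j+m p q (CP.pos d)) e)
  injectivity (cycleP a a<p) (cycleQ b _)     _  _  e = ⊥-elim (separated a<p (m≤m+n p b) e)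
  injectivity (cycleP a a<p) (tailQ d _)      _  _  e = ⊥-elim (separated a<p (i≤i+j+m p q (fromY d)) e)
  injectivity (tailP d _)    (cycleP a a<p)   _  _  e =
    ⊥-elim (separated a<p (i≤i+j+m p q (CP.pos d)) (sym e))
  injectivity (tailP d d<k)  (tailP d' d'<k)  ux uy e =
    cong (p +_) (EmbedTailP.injective (ux , d<k) (uy , d'<k) (+-cancelˡ-≡ (p + q) _ _ e))
  injectivity (tailP d _)    (cycleQ b b<q)   _  _  e =
    ⊥-elim (separated (+-monoʳ-< p b<q) (m≤m+n (p + q) (CP.pos d)) (sym e))
  injectivity (tailP d d<k)  (tailQ d' d'<k)  ux uy e =
    ⊥-elim (apart-≢ (inj₁ (tails-apart (ux , d<k) (uy , d'<k))) (+-cancelˡ-≡ (p + q) _ _ e))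
  injectivity (cycleQ b _)   (cycleP a a<p)   _  _  e = ⊥-elim (separated a<p (m≤m+n p b) (sym e))
  injectivity (cycleQ b b<q) (tailP d _)      _  _  e =
    ⊥-elim (separated (+-monoʳ-< p b<q) (m≤m+n (p + q) (CP.pos d)) e)
  injectivity (cycleQ b _)   (cycleQ b' _)    _  _  e = cong (nP +_) (+-cancelˡ-≡ p _ _ e)
  injectivity (cycleQ b b<q) (tailQ d _)      _  _  e =
    ⊥-elim (separated (+-monoʳ-< p b<q) (m≤m+n (p + q) (fromY d)) e)
  injectivity (tailQ d _)    (cycleP a a<p)   _  _  e = ⊥-elim (separated a<p (i≤i+j+m p q (fromY d)) (sym e))
  injectivity (tailQ d d<k)  (tailP d' d'<k)  ux uy e =
    ⊥-elim (apart-≢ (inj₁ (tails-apart (uy , d'<k) (ux , d<k))) (+-cancelˡ-≡ (p + q) _ _ (sym e)))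
  injectivity (tailQ d _)    (cycleQ b b<q)   _  _  e =
    ⊥-elim (separated (+-monoʳ-< p b<q) (m≤m+n (p + q) (fromY d)) (sym e))
  injectivity (tailQ d d<k)  (tailQ d' d'<k)  ux uy e =
    cong (λ z → nP + (q + z)) (EmbedTailQ.injective (ux , d<k) (uy , d'<k) (+-cancelˡ-≡ (p + q) _ _ e))

  kindOf : (v : Fin n) → Kind (F v)
  kindOf v = kind (F v) (Fin.toℕ<n (f v))

  g : Fin n → Fin Bsize
  g v = fromℕ< (target< (kindOf v) (v , refl))

  g-index : ∀ v → toℕ (g v) ≡ target (kindOf v)
  g-index v = Fin.toℕ-fromℕ< (target< (kindOf v) (v , refl))

  embedding : H ⊑ Butterfly⁺ p q (suc m)
  embedding = g , g-inj , g-adj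
    where
    g-inj : ∀ {u v} → g u ≡ g v → u ≡ v
    g-inj {u} {v} e = proj₁ (proj₂ emb) (Fin.toℕ-injective
      (injectivity (kindOf u) (kindOf v) (u , refl) (v , refl) (trans (sym (g-index u)) (trans (cong toℕ e) (g-index v)))))
    g-adj : ∀ u v → adj H u v ≡ adj (Butterfly⁺ p q (suc m)) (g u) (g v)
    g-adj u v = trans (proj₂ (proj₂ emb) u v) (trans (represents-DD p q k (f u) (f v))
                  (trans (adjacency (kindOf u) (kindOf v) (u , refl) (v , refl))
                  (sym (trans (represents-butterfly p q (suc m) (g u) (g v)) (cong₂ B (g-index u) (g-index v))))))

⊑-trans : ∀ {G₁ G₂ G₃} → G₁ ⊑ G₂ → G₂ ⊑ G₃ → G₁ ⊑ G₃
⊑-trans (f , f-inj , f-adj) (g , g-inj , g-adj) =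
  g ∘ f , f-inj ∘ g-inj , λ u v → trans (f-adj u v) (g-adj (f u) (f v))

⊕-swap : ∀ G G' → (G ⊕ G') ⊑ (G' ⊕ G)
⊕-swap G G' = swap-vertex , swap-inj , swap-adj
  where
  m : ℕ
  m = size G
  n : ℕ
  n = size G'
  swap-vertex : Fin (m + n) → Fin (n + m)
  swap-vertex u with splitAt m u
  ... | inj₁ x = n ↑ʳ x
  ... | inj₂ y = y ↑ˡ m
  swap-left : ∀ x → swap-vertex (x ↑ˡ n) ≡ n ↑ʳ x
  swap-left x rewrite Fin.splitAt-↑ˡ m x n = refl
  swap-right : ∀ y → swap-vertex (m ↑ʳ y) ≡ y ↑ˡ m
  swap-right y rewrite Fin.splitAt-↑ʳ m n y = refl
  halves-differ : ∀ x y → n ↑ʳ x ≢ y ↑ˡ m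
  halves-differ x y e = <-irrefl refl (<-≤-trans (Fin.toℕ<n y)
    (≤-trans (m≤m+n n (toℕ x))
      (≤-reflexive (trans (sym (Fin.toℕ-↑ʳ n x)) (trans (cong toℕ e) (Fin.toℕ-↑ˡ y m))))))
  swap-inj : ∀ {u v} → swap-vertex u ≡ swap-vertex v → u ≡ v
  swap-inj {u} {v} e with splitView m n u | splitView m n v
  ... | inj₁ (x , refl) | inj₁ (y , refl) rewrite swap-left x | swap-left y =
    cong (_↑ˡ n) (Fin.↑ʳ-injective n x y e)
  ... | inj₂ (x , refl) | inj₂ (y , refl) rewrite swap-right x | swap-right y =
    cong (m ↑ʳ_) (Fin.↑ˡ-injective m x y e)
  ... | inj₁ (x , refl) | inj₂ (y , refl) rewrite swap-left x | swap-right y = ⊥-elim (halves-differ x y e)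
  ... | inj₂ (x , refl) | inj₁ (y , refl) rewrite swap-right x | swap-left y = ⊥-elim (halves-differ y x (sym e))
  swap-adj : ∀ u v → adj (G ⊕ G') u v ≡ adj (G' ⊕ G) (swap-vertex u) (swap-vertex v)
  swap-adj u v with splitView m n u | splitView m n v
  ... | inj₁ (x , refl) | inj₁ (y , refl)
    rewrite swap-left x | swap-left y | Fin.splitAt-↑ˡ m x n | Fin.splitAt-↑ˡ m y n
          | Fin.splitAt-↑ʳ n m x | Fin.splitAt-↑ʳ n m y = refl
  ... | inj₁ (x , refl) | inj₂ (y , refl)
    rewrite swap-left x | swap-right y | Fin.splitAt-↑ˡ m x n | Fin.splitAt-↑ʳ m n y
          | Fin.splitAt-↑ʳ n m x | Fin.splitAt-↑ˡ n y m = refl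
  ... | inj₂ (x , refl) | inj₁ (y , refl)
    rewrite swap-right x | swap-left y | Fin.splitAt-↑ʳ m n x | Fin.splitAt-↑ˡ m y n
          | Fin.splitAt-↑ˡ n x m | Fin.splitAt-↑ʳ n m y = refl
  ... | inj₂ (x , refl) | inj₂ (y , refl)
    rewrite swap-right x | swap-right y | Fin.splitAt-↑ʳ m n x | Fin.splitAt-↑ʳ m n y
          | Fin.splitAt-↑ˡ n x m | Fin.splitAt-↑ˡ n y m = refl

fin-positive : ∀ {n} → Fin n → 0 < n
fin-positive {suc n} _ = s≤s z≤n

twice-pred : ∀ n → 0 < n → Σ ℕ λ m → suc m ≡ 2 * n
twice-pred (suc s) _ = s + suc (s + 0) , refl

-- Part (i) for the pair (p, q); an empty H embeds anywhere.
covers-pair : ∀ H p q k → 3 ≤ p → 3 ≤ q → H ⊑ (D p k ⊕ D q k) → Covers H p q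
covers-pair H p q k p≥3 q≥3 emb with 0 <? size H
... | no empty = no-vertex , (λ {u} _ → no-vertex u) , (λ u _ → no-vertex u)
  where no-vertex : ∀ {A : Set} → Fin (size H) → A
        no-vertex u = ⊥-elim (empty (fin-positive u))
... | yes nonempty with twice-pred (size H) nonempty
...   | m , room =
  subst (λ M → H ⊑ Butterfly⁺ p q M) room (TailCompression.embedding H p q k m p≥3 q≥3 room emb)

-- Part (ii): an H containing D^p_k + D^q_k is non-empty, and the embedded cycles
-- identify the pair.
covered-pair : ∀ H p q k i j → 3 ≤ p → 3 ≤ q → 3 ≤ i → 3 ≤ j →
               (D p k ⊕ D q k) ⊑ H → Covers H i j → (i ≡ p × j ≡ q) ⊎ (i ≡ q × j ≡ p)
covered-pair H p q k i j p≥3 q≥3 i≥3 j≥3 emb cov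
  with twice-pred (size H) (fin-positive (proj₁ emb some-vertex))
  where some-vertex : Fin (size (D p k ⊕ D q k))
        some-vertex = fromℕ< (≤-trans (3≤⇒0< p≥3) (≤-trans (r≤size-D p k) (m≤m+n _ _)))
... | m , room = EmbeddedCycles.pairs-equal p q k i j m p≥3 q≥3 i≥3 j≥3
                   (⊑-trans {D p k ⊕ D q k} {H} {Butterfly⁺ i j (suc m)} emb
                            (subst (λ M → H ⊑ Butterfly⁺ i j M) (sym room) cov))

-- Lemma 2; the pair (q, p) in part (i) follows by swapping the two summands.
lemma2 : (H : Graph) (p q : ℕ) → 3 ≤ p → 3 ≤ q →
         ((∃ λ k → H ⊑ (D p k ⊕ D q k)) → Covers H p q × Covers H q p)
         × ((∃ λ k → (D p k ⊕ D q k) ⊑ H) →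
            ∀ i j → 3 ≤ i → 3 ≤ j → Covers H i j →
            (i ≡ p × j ≡ q) ⊎ (i ≡ q × j ≡ p))
lemma2 H p q p≥3 q≥3 = part-i , part-ii
  where
  part-i : (∃ λ k → H ⊑ (D p k ⊕ D q k)) → Covers H p q × Covers H q p
  part-i (k , emb) = covers-pair H p q k p≥3 q≥3 emb ,
                     covers-pair H q p k q≥3 p≥3
                       (⊑-trans {H} {D p k ⊕ D q k} {D q k ⊕ D p k} emb (⊕-swap (D p k) (D q k)))
  part-ii : (∃ λ k → (D p k ⊕ D q k) ⊑ H) → ∀ i j → 3 ≤ i → 3 ≤ j → Covers H i j →
            (i ≡ p × j ≡ q) ⊎ (i ≡ q × j ≡ p)
  part-ii (k , emb) i j i≥3 j≥3 = covered-pair H p q k i j p≥3 q≥3 i≥3 j≥3 emb
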